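{- Let $T$ be a Tangle whose dual graph is a tree with $m$ edges. Then $T$ has class $m+1$, i.e. $T$ consists of $4(m+1)$ links.
   Context: Fix $r>0$ and consider the circles of radius $r$ centered at the points of $L_1=2\sqrt2\,r\,\mathbb Z^2$ and of $L_2=2\sqrt2\,r\,(\mathbb Z^2+(\tfrac12,\tfrac12))$. This is a square packing of the plane (rotated by $45^\circ$): each circle is tangent to four others, at its northeast, northwest, southwest and southeast points. A (planar) Tangle is a smooth simple closed plane curve that is a finite union of links, each link being a quarter of one of these circles joining two consecutive intercardinal points (NE, NW, SW, SE) of that circle. (Any smooth simple closed plane curve made of quarter circles of a common radius can be put in this position by a similarity.) The length of a Tangle is its number of links; a Tangle of length $4c$ is said to have class $c$. Dual graph: the circles of the packing that contain a link of $T$ and whose disks lie in the closed region bounded by $T$ all have centers in the same one of $L_1,L_2$; call it $L_T$. The vertices of the dual graph of $T$ are the points of $L_T$ that are centers of circles whose disks lie in the closed region bounded by $T$; two vertices are joined by an edge if they differ by $(\pm2\sqrt2 r,0)$ or $(0,\pm2\sqrt2 r)$ and the segment joining them does not meet $T$. The dual graph is regarded as a graph (a polystick) with these vertices and edges. -}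

module Defs where

-- Coordinates: a point (x , y) : ℤ × ℤ stands for the plane point
-- (√2 r x , √2 r y)  (scaling only, no rotation).  Then
--   L₁ = {(x,y) : x, y even},  L₂ = {(x,y) : x, y odd},
--   circle centres = L₁ ∪ L₂ = {(x,y) : 2 ∣ x - y}, radius 1/√2,
--   the intercardinal points of the circle at c are c + (±1/2, ±1/2),
--   i.e. the tangency points of the packing.
-- A tangency point p + (1/2 , 1/2) is encoded by p : ℤ × ℤ.

open import Data.Bool using (Bool; true; false; _∧_; _∨_)
open import Data.Nat using (ℕ; suc; _≤_) renaming (_%_ to _%ℕ_)
open import Data.Integer using (ℤ; +_; _+_; _-_; -_) renaming (_≤?_ to _≤ℤ?_)
import Data.Integer as ℤ
open import Data.Integer.Divisibility using (_∣_)
open import Data.Product using (_×_; _,_; proj₁; proj₂; ∃; ∃-syntax; Σ)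
open import Data.Sum using (_⊎_)
open import Data.List using (List; []; _∷_; length; filterᵇ; _∷ʳ_)
open import Data.List.Membership.Propositional using (_∈_; _∉_)
open import Data.List.Relation.Unary.Unique.Propositional using (Unique)
open import Data.List.Relation.Unary.Linked using (Linked)
open import Relation.Binary.PropositionalEquality using (_≡_; _≢_)
open import Relation.Binary.Construct.Closure.ReflexiveTransitive using (Star)
open import Relation.Nullary using (¬_)
open import Relation.Nullary.Decidable using (⌊_⌋)

Point : Set
Point = ℤ × ℤ

IsCentre : Point → Set
IsCentre (x , y) = + 2 ∣ (x - y)

-- the four quarter circles of a circle: N = from NE to NW, E = from NE to SE,
-- S = from SW to SE, W = from NW to SW.
data Dir : Set where
  N E S W : Dir

opposite : Dir → Dir
opposite N = S
opposite S = N
opposite E = W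
opposite W = E

Link : Set
Link = Point × Dir

centre : Link → Point
centre = proj₁

NEpt NWpt SWpt SEpt : Point → Point
NEpt (x , y) = (x , y)
NWpt (x , y) = (x - + 1 , y)
SWpt (x , y) = (x - + 1 , y - + 1)
SEpt (x , y) = (x , y - + 1)

endpoints : Link → Point × Point
endpoints (c , N) = (NEpt c , NWpt c)
endpoints (c , E) = (NEpt c , SEpt c)
endpoints (c , S) = (SWpt c , SEpt c)
endpoints (c , W) = (NWpt c , SWpt c)

HasEndpoint : Link → Point → Set
HasEndpoint ℓ p = p ≡ proj₁ (endpoints ℓ) ⊎ p ≡ proj₂ (endpoints ℓ)

-- Two distinct links meeting at a common endpoint join smoothly there iff
-- they lie on the same circle, or they lie on the two tangent circles and
-- are opposite quarters (N/S or E/W); the other two combinations form cusps.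
SmoothJoin : Link → Link → Set
SmoothJoin ℓ ℓ' = centre ℓ ≡ centre ℓ' ⊎ proj₂ ℓ' ≡ opposite (proj₂ ℓ)

Adjacent : List Link → Link → Link → Set
Adjacent T ℓ ℓ' = ℓ ∈ T × ℓ' ∈ T × ∃[ p ] (HasEndpoint ℓ p × HasEndpoint ℓ' p)

-- T (a finite set of links, given as a duplicate-free list) is a Tangle:
-- its union is a smooth simple closed curve.
record IsTangle (T : List Link) : Set where
  field
    nonempty   : ∃[ ℓ ] (ℓ ∈ T)
    distinct   : Unique T
    centres    : ∀ ℓ → ℓ ∈ T → IsCentre (centre ℓ)
    degreeTwo  : ∀ ℓ p → ℓ ∈ T → HasEndpoint ℓ p →
                 ∃[ ℓ' ] (ℓ' ∈ T × ℓ' ≢ ℓ × HasEndpoint ℓ' p × SmoothJoin ℓ ℓ' ×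
                   (∀ ℓ'' → ℓ'' ∈ T → HasEndpoint ℓ'' p → ℓ'' ≡ ℓ ⊎ ℓ'' ≡ ℓ'))
    connected  : ∀ ℓ ℓ' → ℓ ∈ T → ℓ' ∈ T → Star (Adjacent T) ℓ ℓ'

-- The open disks and the open "holes" of the packing
-- are disjoint from T, hence each lies wholly inside or outside T.  The
-- horizontal ray from the centre (a , b) to the east crosses (transversally,
-- away from tangency points) exactly the E-quarters of circles (x , b) with
-- x ≥ a and the W-quarters of circles (x , b) with x ≥ a + 1.
crossesᵇ : Point → Link → Bool
crossesᵇ (a , b) ((x , y) , E) = ⌊ y ℤ.≟ b ⌋ ∧ ⌊ a ≤ℤ? x ⌋
crossesᵇ (a , b) ((x , y) , W) = ⌊ y ℤ.≟ b ⌋ ∧ ⌊ a + + 1 ≤ℤ? x ⌋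
crossesᵇ _ (_ , N) = false
crossesᵇ _ (_ , S) = false

crossings : List Link → Point → ℕ
crossings T v = length (filterᵇ (crossesᵇ v) T)

-- the (open) disk centred at v lies in the region bounded by T
-- (odd crossing number); equivalently the closed disk lies in the closed region
DiskInside : List Link → Point → Set
DiskInside T v = crossings T v %ℕ 2 ≡ 1

InLT : List Link → Point → Set
InLT T v = ∃[ ℓ ] (ℓ ∈ T × DiskInside T (centre ℓ) × + 2 ∣ (proj₁ (centre ℓ) - proj₁ v))

DualVertex : List Link → Point → Set
DualVertex T v = IsCentre v × InLT T v × DiskInside T v

-- edge directions (each undirected edge is recorded once, from its
-- western / southern end)
data EDir : Set where
  east north : EDir

shift : Point → EDir → Point
shift (x , y) east  = (x + + 2 , y)
shift (x , y) north = (x , y + + 2)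

-- quarter of the circle at the start / end met by the segment
startQuarter endQuarter : EDir → Dir
startQuarter east  = E
startQuarter north = N
endQuarter east  = W
endQuarter north = S

-- (v , d) is an edge of the dual graph: both ends are vertices and the
-- segment from v to shift v d does not meet T (it meets only the circles at
-- its two ends, at the quarters startQuarter d / endQuarter d)
DualEdge : List Link → Point × EDir → Set
DualEdge T (v , d) = DualVertex T v × DualVertex T (shift v d) ×
                     (v , startQuarter d) ∉ T × (shift v d , endQuarter d) ∉ T

DualAdj : List Link → Point → Point → Set
DualAdj T v w = ∃[ d ] ((DualEdge T (v , d) × w ≡ shift v d) ⊎ (DualEdge T (w , d) × v ≡ shift w d))

record DualIsTree (T : List Link) : Set where
  field
    hasVertex : ∃[ v ] DualVertex T v
    connected : ∀ v w → DualVertex T v → DualVertex T w → Star (DualAdj T) v w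
    acyclic   : ∀ v vs → 2 ≤ length vs → Unique (v ∷ vs) → ¬ Linked (DualAdj T) (v ∷ vs ∷ʳ v)

-- A cell of the packing (disk or hole) is inside T iff the ray from its centre to the east
-- crosses T an odd number of times; stepping to a neighbouring cell flips this exactly when
-- a link of T separates the two.  At a point of T the link and the quarter of the other
-- tangent circle bordering the same hole would form a cusp, so the two circles tangent there
-- lie on opposite sides of T.  Walking along T, the circles carrying inner links therefore
-- all lie in one lattice L_T and those carrying outer links in the other.  No circle of the
-- other lattice is inside T, for then its four neighbours in L_T would form a 4-cycle of the
-- dual tree.  Hence the links of T match the quarters of the circles at the vertices: an
-- inner link is such a quarter itself, an outer link corresponds to the quarter of the next
-- circle clockwise around the hole it borders.  So T has 4 |V| links, and |V| = m + 1.

module Submission where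

open import Defs
open import Data.Nat using (ℕ; suc; _*_)
open import Data.Product using (_×_)
open import Data.List using (List; length)
open import Data.List.Membership.Propositional using (_∈_)
open import Data.List.Relation.Unary.Unique.Propositional using (Unique)
open import Relation.Binary.PropositionalEquality using (_≡_)

open import Algebra.Bundles using (CommutativeRing)
import Algebra.Properties.CommutativeSemigroup as CommutativeSemigroupProperties
open import Data.Bool using (Bool; true; false; _∧_; _∨_; not; _xor_; if_then_else_)
import Data.Bool as Bool
open import Data.Bool.Properties
  using ( ∧-comm; ∧-zeroʳ; ∧-identityʳ; ∧-distribˡ-xor; not-¬; ¬-not; not-involutive; not-injective
        ; xor-comm; xor-assoc; xor-same; xor-identityʳ; xor-inverseˡ; true-xor; not-distribʳ-xor
        ; xor-∧-commutativeRing )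
open import Data.Empty using (⊥-elim)
open import Data.Integer using (ℤ; +_; -[1+_]; _+_; _-_; -_; ∣_∣)
import Data.Integer as ℤ
open import Data.Integer.Divisibility using (_∣_)
import Data.Integer.Properties as ℤP
open import Data.Integer.Tactic.RingSolver using (solve-∀)
open import Data.List using ([]; _∷_; filterᵇ; map; _++_; _∷ʳ_; cartesianProduct; deduplicate)
import Data.List.Membership.DecPropositional as DecMembership
open import Data.List.Membership.Propositional using (_∉_; find; lose)
open import Data.List.Membership.Propositional.Properties
  using ( ∈-∃++; ∈-deduplicate⁺; ∈-deduplicate⁻; ∈-++⁺ˡ; ∈-++⁺ʳ; ∈-map⁺; ∈-map⁻
        ; ∈-cartesianProduct⁺; ∈-cartesianProduct⁻ )
open import Data.List.Membership.Propositional.Properties.WithK using (unique∧set⇒bag)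
open import Data.List.Properties using (length-++; length-map)
open import Data.List.Relation.Binary.BagAndSetEquality using (∼bag⇒↭)
open import Data.List.Relation.Binary.Permutation.Propositional.Properties using (↭-length)
open import Data.List.Relation.Binary.Subset.Propositional using (_⊆_)
open import Data.List.Relation.Unary.All using ([]; _∷_)
import Data.List.Relation.Unary.All as All
open import Data.List.Relation.Unary.All.Properties using (¬Any⇒All¬)
import Data.List.Relation.Unary.All.Properties as AllP
open import Data.List.Relation.Unary.AllPairs using ([]; _∷_)
open import Data.List.Relation.Unary.Any using (here; there; any?)
open import Data.List.Relation.Unary.Linked using (Linked; []; [-]; _∷_)
import Data.List.Relation.Unary.Linked as Linked
open import Data.List.Relation.Unary.Unique.DecPropositional.Properties using (deduplicate-!)
open import Data.List.Relation.Unary.Unique.Propositional.Properties using (cartesianProduct⁺)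
open import Data.Nat using (zero; _≤_; z≤n; s≤s)
import Data.Nat as ℕ
import Data.Nat.Divisibility as ℕD
import Data.Nat.Properties as ℕP
open import Data.Product using (_,_; proj₁; proj₂; Σ; ∃-syntax)
open import Data.Product.Properties using () renaming (≡-dec to ×-≡-dec)
open import Data.Sum using (_⊎_; inj₁; inj₂; [_,_])
open import Function using (_∘_; _⇔_; mk⇔; case_of_)
open import Function.Bundles using (Equivalence)
open import Relation.Binary.Construct.Closure.ReflexiveTransitive using (Star; ε; _◅_; _◅◅_)
import Relation.Binary.Construct.Closure.ReflexiveTransitive as Star
open import Relation.Binary.Definitions using (DecidableEquality; tri<; tri≈; tri>)
open import Relation.Binary.PropositionalEquality
  using (_≢_; refl; sym; trans; cong; cong₂; subst; module ≡-Reasoning)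
open import Relation.Nullary using (¬_; Dec; yes; no; does; _because_)
open import Relation.Nullary.Decidable using (⌊_⌋; dec-true; dec-false)
open import Relation.Nullary.Reflects using (Reflects; ofʸ; ofⁿ)
open import Algebra.Properties.AbelianGroup ℤP.+-0-abelianGroup using (∙-cancelˡ)

open CommutativeSemigroupProperties (CommutativeRing.+-commutativeSemigroup xor-∧-commutativeRing)
  using () renaming (interchange to xor-interchange)

does-true⇒ : ∀ {P : Set} (p? : Dec P) → does p? ≡ true → P
does-true⇒ (yes p) _ = p

⌊⌋-true : ∀ {P : Set} (p? : Dec P) → P → ⌊ p? ⌋ ≡ true
⌊⌋-true (yes _) _ = refl
⌊⌋-true (no ¬p) p = ⊥-elim (¬p p)

⌊⌋-false : ∀ {P : Set} (p? : Dec P) → ¬ P → ⌊ p? ⌋ ≡ false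
⌊⌋-false (yes p) ¬p = ⊥-elim (¬p p)
⌊⌋-false (no _)  _  = refl

⌊⌋-cong : ∀ {P Q : Set} (p? : Dec P) (q? : Dec Q) → (P → Q) → (Q → P) → ⌊ p? ⌋ ≡ ⌊ q? ⌋
⌊⌋-cong (yes p) q? to from = sym (⌊⌋-true q? (to p))
⌊⌋-cong (no ¬p) q? to from = sym (⌊⌋-false q? (¬p ∘ from))

xor≡∨ : ∀ b c → (b ≡ true → c ≡ false) → b xor c ≡ b ∨ c
xor≡∨ true  c disjoint = cong not (disjoint refl)
xor≡∨ false c disjoint = refl

xor≡false⇔≡ : ∀ a b → a xor b ≡ false ⇔ a ≡ b
xor≡false⇔≡ a b = mk⇔ (to a b) (λ { refl → xor-same a })
  where
  to : ∀ a b → a xor b ≡ false → a ≡ b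
  to true  true  _ = refl
  to false false _ = refl

xor-falseʳ : ∀ {a b} → b ≡ false → a xor b ≡ a
xor-falseʳ {a} refl = xor-identityʳ a

xor-falseˡ : ∀ {a b} → a ≡ false → a xor b ≡ b
xor-falseˡ refl = refl

xor-cancelʳ : ∀ a b → (a xor b) xor b ≡ a
xor-cancelʳ a b = trans (xor-assoc a b b) (trans (cong (a xor_) (xor-same b)) (xor-identityʳ a))

xor-cancel-common : ∀ a b h → (a xor h) xor (b xor h) ≡ a xor b
xor-cancel-common a b h = begin
  (a xor h) xor (b xor h) ≡⟨ xor-interchange a h b h ⟩
  (a xor b) xor (h xor h) ≡⟨ cong ((a xor b) xor_) (xor-same h) ⟩
  (a xor b) xor false     ≡⟨ xor-identityʳ (a xor b) ⟩
  a xor b                 ∎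
  where open ≡-Reasoning

xor-true≡false : ∀ {a} → a xor true ≡ false → a ≡ true
xor-true≡false {true} _ = refl

xor-flip : ∀ a b p → a xor b ≡ true → a xor p ≡ b xor not p
xor-flip true  false p _ = refl
xor-flip false true  p _ = sym (not-involutive p)

xor-injectiveʳ : ∀ c {a b} → c xor a ≡ c xor b → a ≡ b
xor-injectiveʳ true  same = not-injective same
xor-injectiveʳ false same = same

-- Parity of a count

module _ {A : Set} where

  oddCount : (A → Bool) → List A → Bool
  oddCount f []       = false
  oddCount f (x ∷ xs) = f x xor oddCount f xs

  oddCount-cong : ∀ {f g : A → Bool} xs → (∀ {x} → x ∈ xs → f x ≡ g x) →
    oddCount f xs ≡ oddCount g xs
  oddCount-cong []       f≗g = refl
  oddCount-cong (x ∷ xs) f≗g = cong₂ _xor_ (f≗g (here refl)) (oddCount-cong xs (f≗g ∘ there))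

  oddCount-none : ∀ {f : A → Bool} xs → (∀ {x} → x ∈ xs → f x ≡ false) → oddCount f xs ≡ false
  oddCount-none []       none = refl
  oddCount-none (x ∷ xs) none = cong₂ _xor_ (none (here refl)) (oddCount-none xs (none ∘ there))

  oddCount-xor : ∀ (f g : A → Bool) xs →
    oddCount (λ x → f x xor g x) xs ≡ oddCount f xs xor oddCount g xs
  oddCount-xor f g []       = refl
  oddCount-xor f g (x ∷ xs) = begin
    (f x xor g x) xor oddCount (λ x → f x xor g x) xs
      ≡⟨ cong ((f x xor g x) xor_) (oddCount-xor f g xs) ⟩
    (f x xor g x) xor (oddCount f xs xor oddCount g xs)
      ≡⟨ xor-interchange (f x) (g x) _ _ ⟩
    (f x xor oddCount f xs) xor (g x xor oddCount g xs) ∎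
    where open ≡-Reasoning

  oddCount-∧ˡ : ∀ b (f : A → Bool) xs → oddCount (λ x → b ∧ f x) xs ≡ b ∧ oddCount f xs
  oddCount-∧ˡ true  f xs = refl
  oddCount-∧ˡ false f xs = oddCount-none xs (λ _ → refl)

  module _ (_≟_ : DecidableEquality A) where
    open DecMembership _≟_ using (_∈?_)

    oddCount-≟ : ∀ a {xs} → Unique xs → oddCount (λ x → does (a ≟ x)) xs ≡ does (a ∈? xs)
    oddCount-≟ a {[]}     []         = refl
    oddCount-≟ a {x ∷ xs} (x∉ ∷ !xs) = begin
      does (a ≟ x) xor oddCount (λ y → does (a ≟ y)) xs ≡⟨ cong (does (a ≟ x) xor_) (oddCount-≟ a !xs) ⟩
      does (a ≟ x) xor does (a ∈? xs)                    ≡⟨ xor≡∨ _ _ a≡x⇒a∉xs ⟩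
      does (a ≟ x) ∨ does (a ∈? xs)                      ∎
      where
      open ≡-Reasoning
      a≡x⇒a∉xs : does (a ≟ x) ≡ true → does (a ∈? xs) ≡ false
      a≡x⇒a∉xs a≡x with refl ← does-true⇒ (a ≟ x) a≡x =
        dec-false (a ∈? xs) (λ a∈ → All.lookup x∉ a∈ refl)

    oddCount-pick : ∀ (χ : A → Bool) {xs s} → Unique xs → s ∈ xs →
      oddCount (λ x → χ x ∧ does (s ≟ x)) xs ≡ χ s
    oddCount-pick χ {xs} {s} !xs s∈ = begin
      oddCount (λ x → χ x ∧ does (s ≟ x)) xs ≡⟨ oddCount-cong xs (λ {x} _ → only-s x) ⟩
      oddCount (λ x → χ s ∧ does (s ≟ x)) xs ≡⟨ oddCount-∧ˡ (χ s) _ xs ⟩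
      χ s ∧ oddCount (λ x → does (s ≟ x)) xs ≡⟨ cong (χ s ∧_) (oddCount-≟ s !xs) ⟩
      χ s ∧ does (s ∈? xs)                   ≡⟨ cong (χ s ∧_) (dec-true (s ∈? xs) s∈) ⟩
      χ s ∧ true                             ≡⟨ ∧-identityʳ (χ s) ⟩
      χ s                                    ∎
      where
      open ≡-Reasoning
      only-s : ∀ x → χ x ∧ does (s ≟ x) ≡ χ s ∧ does (s ≟ x)
      only-s x with s ≟ x
      ... | yes refl = refl
      ... | no _     = trans (∧-zeroʳ (χ x)) (sym (∧-zeroʳ (χ s)))

oddCount-swap : ∀ {A B : Set} (h : A → B → Bool) xs ys →
  oddCount (λ x → oddCount (h x) ys) xs ≡ oddCount (λ y → oddCount (λ x → h x y) xs) ys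
oddCount-swap h []       ys = sym (oddCount-none ys (λ _ → refl))
oddCount-swap h (x ∷ xs) ys = begin
  oddCount (h x) ys xor oddCount (λ x → oddCount (h x) ys) xs
    ≡⟨ cong (oddCount (h x) ys xor_) (oddCount-swap h xs ys) ⟩
  oddCount (h x) ys xor oddCount (λ y → oddCount (λ x → h x y) xs) ys
    ≡⟨ oddCount-xor (h x) _ ys ⟨
  oddCount (λ y → h x y xor oddCount (λ x → h x y) xs) ys ∎
  where open ≡-Reasoning

isOdd : ℕ → Bool
isOdd zero    = false
isOdd (suc n) = not (isOdd n)

isOdd-length-filterᵇ : ∀ {A : Set} (f : A → Bool) xs → isOdd (length (filterᵇ f xs)) ≡ oddCount f xs
isOdd-length-filterᵇ f []       = refl
isOdd-length-filterᵇ f (x ∷ xs) with f x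
... | true  = cong not (isOdd-length-filterᵇ f xs)
... | false = isOdd-length-filterᵇ f xs

isOdd⇔%2≡1 : ∀ n → isOdd n ≡ true ⇔ n ℕ.% 2 ≡ 1
isOdd⇔%2≡1 zero          = mk⇔ (λ ()) (λ ())
isOdd⇔%2≡1 (suc zero)    = mk⇔ (λ _ → refl) (λ _ → refl)
isOdd⇔%2≡1 (suc (suc n)) rewrite not-involutive (isOdd n) = isOdd⇔%2≡1 n

module _ {A : Set} where

  filterᵇ-cong : ∀ {f g : A → Bool} xs → (∀ {x} → x ∈ xs → f x ≡ g x) → filterᵇ f xs ≡ filterᵇ g xs
  filterᵇ-cong           []       f≗g = refl
  filterᵇ-cong {g = g} (x ∷ xs) f≗g rewrite f≗g (here refl) with g x
  ... | true  = cong (x ∷_) (filterᵇ-cong xs (f≗g ∘ there))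
  ... | false = filterᵇ-cong xs (f≗g ∘ there)

  length-filterᵇ-all : ∀ {f : A → Bool} xs → (∀ {x} → x ∈ xs → f x ≡ true) →
    length (filterᵇ f xs) ≡ length xs
  length-filterᵇ-all []       all = refl
  length-filterᵇ-all (x ∷ xs) all rewrite all (here refl) = cong suc (length-filterᵇ-all xs (all ∘ there))

  length-filterᵇ-none : ∀ {f : A → Bool} xs → (∀ {x} → x ∈ xs → f x ≡ false) →
    length (filterᵇ f xs) ≡ 0
  length-filterᵇ-none []       none = refl
  length-filterᵇ-none (x ∷ xs) none rewrite none (here refl) = length-filterᵇ-none xs (none ∘ there)

  length-filterᵇ-drop : ∀ {f g : A → Bool} {xs r} → Unique xs → r ∈ xs → f r ≡ true → g r ≡ false →
    (∀ {x} → x ∈ xs → x ≢ r → f x ≡ g x) → length (filterᵇ f xs) ≡ suc (length (filterᵇ g xs))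
  length-filterᵇ-drop {xs = x ∷ xs} (x∉ ∷ _) (here refl) fr gr agree rewrite fr | gr =
    cong (suc ∘ length) (filterᵇ-cong xs (λ y∈ → agree (there y∈) (λ { refl → All.lookup x∉ y∈ refl })))
  length-filterᵇ-drop {g = g} {x ∷ xs} (x∉ ∷ !xs) (there r∈) fr gr agree
    rewrite agree (here refl) (λ { refl → All.lookup x∉ r∈ refl }) with g x
  ... | true  = cong suc (length-filterᵇ-drop !xs r∈ fr gr (agree ∘ there))
  ... | false = length-filterᵇ-drop !xs r∈ fr gr (agree ∘ there)

  unique∧set⇒length≡ : ∀ {xs ys : List A} → Unique xs → Unique ys → (∀ {x} → x ∈ xs ⇔ x ∈ ys) →
    length xs ≡ length ys
  unique∧set⇒length≡ !xs !ys xs∼ys = ↭-length (∼bag⇒↭ (unique∧set⇒bag !xs !ys xs∼ys))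

  unique-map⁺ : ∀ {B : Set} {f : A → B} {xs} → Unique xs →
    (∀ {x y} → x ∈ xs → y ∈ xs → f x ≡ f y → x ≡ y) → Unique (map f xs)
  unique-map⁺ {xs = []}     []         injective = []
  unique-map⁺ {xs = x ∷ xs} (x∉ ∷ !xs) injective =
    AllP.map⁺ (All.tabulate (λ y∈ fx≡fy → All.lookup x∉ y∈ (injective (here refl) (there y∈) fx≡fy))) ∷
    unique-map⁺ !xs (λ x∈ y∈ → injective (there x∈) (there y∈))

  length-cartesianProduct : ∀ {B : Set} (xs : List A) (ys : List B) →
    length (cartesianProduct xs ys) ≡ length xs * length ys
  length-cartesianProduct []       ys = refl
  length-cartesianProduct (x ∷ xs) ys = begin
    length (map (x ,_) ys ++ cartesianProduct xs ys)
      ≡⟨ length-++ (map (x ,_) ys) ⟩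
    length (map (x ,_) ys) ℕ.+ length (cartesianProduct xs ys)
      ≡⟨ cong₂ ℕ._+_ (length-map (x ,_) ys) (length-cartesianProduct xs ys) ⟩
    length ys ℕ.+ length xs * length ys ∎
    where open ≡-Reasoning

module _ {V : Set} where

  lastOf : V → List V → V
  lastOf u []       = u
  lastOf u (v ∷ vs) = lastOf v vs

  lastOf-++ : ∀ u (pre : List V) v suf → lastOf u (pre ++ v ∷ suf) ≡ lastOf v suf
  lastOf-++ u []        v suf = refl
  lastOf-++ u (w ∷ pre) v suf = lastOf-++ w pre v suf

  linked-suffix : ∀ {R : V → V → Set} (pre : List V) {v suf} →
    Linked R (pre ++ v ∷ suf) → Linked R (v ∷ suf)
  linked-suffix []             steps       = steps
  linked-suffix (w ∷ [])       (_ ∷ steps) = steps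
  linked-suffix (w ∷ w′ ∷ pre) (_ ∷ steps) = linked-suffix (w′ ∷ pre) steps

  unique-suffix : ∀ (pre : List V) {suf} → Unique (pre ++ suf) → Unique suf
  unique-suffix []        distinct       = distinct
  unique-suffix (w ∷ pre) (_ ∷ distinct) = unique-suffix pre distinct

  linked-∷ʳ : ∀ {R : V → V → Set} {u} vs {w} →
    Linked R (u ∷ vs) → R (lastOf u vs) w → Linked R (u ∷ vs ∷ʳ w)
  linked-∷ʳ []       _               step = step ∷ [-]
  linked-∷ʳ (v ∷ vs) (step₀ ∷ steps) step = step₀ ∷ linked-∷ʳ vs steps step

  record SimplePath (R : V → V → Set) (u w : V) : Set where
    field
      via      : List V
      distinct : Unique (u ∷ via)
      steps    : Linked R (u ∷ via)
      ends     : lastOf u via ≡ w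

  module _ (_≟_ : DecidableEquality V) {R : V → V → Set} where
    open DecMembership _≟_ using (_∈?_)

    shortcut : ∀ {u w} → Star R u w → SimplePath R u w
    shortcut ε = record { via = [] ; distinct = [] ∷ [] ; steps = [-] ; ends = refl }
    shortcut {u} (_◅_ {j = v} step rest) with shortcut rest
    ... | record { via = vs ; distinct = distinct ; steps = steps ; ends = ends } with u ∈? (v ∷ vs)
    ... | no u∉ = record
      { via = v ∷ vs ; distinct = ¬Any⇒All¬ (v ∷ vs) u∉ ∷ distinct ; steps = step ∷ steps ; ends = ends }
    ... | yes u∈ with pre , suf , vs≡ ← ∈-∃++ u∈ = record
      { via      = suf
      ; distinct = unique-suffix pre (subst Unique vs≡ distinct)
      ; steps    = linked-suffix pre (subst (Linked R) vs≡ steps)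
      ; ends     = trans (sym (lastOf-++ v pre u suf)) (trans (cong (lastOf v) (sym vs≡)) ends)
      }

-- The number of edges of a tree

module EdgeList {V E : Set} (src tgt : E → V) where

  Joins : E → V → V → Set
  Joins e a b = (src e ≡ a × tgt e ≡ b) ⊎ (src e ≡ b × tgt e ≡ a)

  Joined : List E → V → V → Set
  Joined Fs a b = ∃[ e ] (e ∈ Fs × Joins e a b)

  joined-sym : ∀ {Fs a b} → Joined Fs a b → Joined Fs b a
  joined-sym (e , e∈ , inj₁ (p , q)) = e , e∈ , inj₂ (p , q)
  joined-sym (e , e∈ , inj₂ (p , q)) = e , e∈ , inj₁ (p , q)

  joined-⊆ : ∀ {Fs Gs a b} → Fs ⊆ Gs → Joined Fs a b → Joined Gs a b
  joined-⊆ Fs⊆Gs (e , e∈ , joins) = e , Fs⊆Gs e∈ , joins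

  module TreeCount
    (_≟_ : DecidableEquality V) (Vs : List V) (Es : List E) (!Vs : Unique Vs) (!Es : Unique Es)
    (ends∈ : ∀ {e} → e ∈ Es → src e ∈ Vs × tgt e ∈ Vs)
    (noLoop : ∀ e → src e ≢ tgt e)
    (noParallel : ∀ {e f} → Joins f (src e) (tgt e) → e ≡ f)
    (acyclic : ∀ v vs → 2 ≤ length vs → Unique (v ∷ vs) → ¬ Linked (Joined Es) (v ∷ vs ∷ʳ v))
    (connected : ∀ {a b} → a ∈ Vs → b ∈ Vs → Star (Joined Es) a b)
    where

    -- Shortcut to a simple path, such a path would close up with e to a loop, a parallel edge or a cycle.
    no-detour : ∀ {e Fs} → e ∷ Fs ⊆ Es → Unique (e ∷ Fs) → ¬ Star (Joined Fs) (src e) (tgt e)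
    no-detour {e} {Fs} e∷Fs⊆ (e∉ ∷ _) path with shortcut _≟_ path
    ... | record { via = [] ; ends = ends } = noLoop e ends
    ... | record { via = _ ∷ [] ; steps = (f , f∈ , joins) ∷ [-] ; ends = refl } =
      All.lookup e∉ f∈ (noParallel joins)
    ... | record { via = vs@(_ ∷ _ ∷ _) ; distinct = distinct ; steps = steps ; ends = ends } =
      acyclic (src e) vs (s≤s (s≤s z≤n)) distinct
        (Linked.map (joined-⊆ e∷Fs⊆) (linked-∷ʳ vs (Linked.map (joined-⊆ there) steps) closing))
      where
      closing : Joined (e ∷ Fs) (lastOf (src e) vs) (src e)
      closing = subst (λ w → Joined (e ∷ Fs) w (src e)) (sym ends) (e , here refl , inj₂ (refl , refl))

    isRoot : (V → V) → V → Bool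
    isRoot lab x = does (lab x ≟ x)

    -- lab sends every vertex to a chosen root of its component in the forest (Vs , Fs),
    -- so the roots count the components.
    record Labelling (Fs : List E) (lab : V → V) : Set where
      field
        root∈       : ∀ {x} → x ∈ Vs → lab x ∈ Vs
        root-root   : ∀ {x} → x ∈ Vs → lab (lab x) ≡ lab x
        root-edge   : ∀ {e} → e ∈ Fs → lab (src e) ≡ lab (tgt e)
        root-reach  : ∀ {x} → x ∈ Vs → Star (Joined Fs) x (lab x)
        roots+edges : length (filterᵇ (isRoot lab) Vs) ℕ.+ length Fs ≡ length Vs

    module Merge {Fs lab} (L : Labelling Fs lab) (e : E) (u∈ : src e ∈ Vs) (v∈ : tgt e ∈ Vs)
                 (apart : lab (src e) ≢ lab (tgt e)) where
      open Labelling L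

      relabel : V → V
      relabel r = if does (r ≟ lab (tgt e)) then lab (src e) else r

      merged : V → V
      merged = relabel ∘ lab

      relabel-cases : ∀ r → (r ≡ lab (tgt e) × relabel r ≡ lab (src e)) ⊎ (r ≢ lab (tgt e) × relabel r ≡ r)
      relabel-cases r with r ≟ lab (tgt e)
      ... | yes r≡ = inj₁ (r≡ , refl)
      ... | no r≢  = inj₂ (r≢ , refl)

      relabel-root : ∀ {x} → x ∈ Vs → lab x ≢ lab (tgt e) → relabel (lab x) ≡ lab x
      relabel-root {x} x∈ x≁v with relabel-cases (lab x)
      ... | inj₁ (x∼v , _)  = ⊥-elim (x≁v x∼v)
      ... | inj₂ (_ , same) = same

      merged-root : ∀ {x} → x ∈ Vs → merged (merged x) ≡ merged x
      merged-root {x} x∈ with relabel-cases (lab x)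
      ... | inj₁ (_ , m≡) rewrite m≡ = trans (cong relabel (root-root u∈)) (relabel-root u∈ apart)
      ... | inj₂ (x≁v , m≡) rewrite m≡ = trans (cong relabel (root-root x∈)) (relabel-root x∈ x≁v)

      merged∈ : ∀ {x} → x ∈ Vs → merged x ∈ Vs
      merged∈ {x} x∈ with relabel-cases (lab x)
      ... | inj₁ (_ , m≡) = subst (_∈ Vs) (sym m≡) (root∈ u∈)
      ... | inj₂ (_ , m≡) = subst (_∈ Vs) (sym m≡) (root∈ x∈)

      merged-edge : ∀ {f} → f ∈ e ∷ Fs → merged (src f) ≡ merged (tgt f)
      merged-edge (here refl) with relabel-cases (lab (tgt e))
      ... | inj₁ (_ , m≡)    = trans (relabel-root u∈ apart) (sym m≡)
      ... | inj₂ (v≁v , _)   = ⊥-elim (v≁v refl)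
      merged-edge (there f∈) = cong relabel (root-edge f∈)

      widen : ∀ {a b} → Star (Joined Fs) a b → Star (Joined (e ∷ Fs)) a b
      widen = Star.map (joined-⊆ there)

      merged-reach : ∀ {x} → x ∈ Vs → Star (Joined (e ∷ Fs)) x (merged x)
      merged-reach {x} x∈ with relabel-cases (lab x)
      ... | inj₂ (_ , m≡) = subst (Star (Joined (e ∷ Fs)) x) (sym m≡) (widen (root-reach x∈))
      ... | inj₁ (x∼v , m≡) = subst (Star (Joined (e ∷ Fs)) x) (sym m≡)
        (widen (root-reach x∈) ◅◅ root-to-v ◅◅ (e , here refl , inj₂ (refl , refl)) ◅ widen (root-reach u∈))
        where
        root-to-v : Star (Joined (e ∷ Fs)) (lab x) (tgt e)
        root-to-v = subst (λ r → Star (Joined (e ∷ Fs)) r (tgt e)) (sym x∼v)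
          (widen (Star.reverse joined-sym (root-reach v∈)))

      roots-drop : length (filterᵇ (isRoot lab) Vs) ≡ suc (length (filterᵇ (isRoot merged) Vs))
      roots-drop = length-filterᵇ-drop !Vs (root∈ v∈) (dec-true (_ ≟ _) (root-root v∈)) v-root-demoted agree
        where
        v-root-demoted : isRoot merged (lab (tgt e)) ≡ false
        v-root-demoted with relabel-cases (lab (lab (tgt e)))
        ... | inj₁ (_ , m≡) rewrite m≡ = dec-false (_ ≟ _) apart
        ... | inj₂ (v≁v , _) = ⊥-elim (v≁v (root-root v∈))
        agree : ∀ {x} → x ∈ Vs → x ≢ lab (tgt e) → isRoot lab x ≡ isRoot merged x
        agree {x} x∈ x≢v with relabel-cases (lab x)
        ... | inj₂ (_ , m≡) rewrite m≡ = refl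
        ... | inj₁ (x∼v , m≡) rewrite m≡ =
          trans (dec-false (lab x ≟ x) x-not-root) (sym (dec-false (lab (src e) ≟ x) u-not-x))
          where
          x-not-root : lab x ≢ x
          x-not-root x-root = x≢v (trans (sym x-root) x∼v)
          u-not-x : lab (src e) ≢ x
          u-not-x u≡x = apart (trans (trans (sym (root-root u∈)) (cong lab u≡x)) x∼v)

      labelling : Labelling (e ∷ Fs) merged
      labelling = record
        { root∈       = merged∈
        ; root-root   = merged-root
        ; root-edge   = merged-edge
        ; root-reach  = merged-reach
        ; roots+edges = begin
            length (filterᵇ (isRoot merged) Vs) ℕ.+ suc (length Fs) ≡⟨ ℕP.+-suc _ (length Fs) ⟩
            suc (length (filterᵇ (isRoot merged) Vs)) ℕ.+ length Fs ≡⟨ cong (ℕ._+ length Fs) roots-drop ⟨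
            length (filterᵇ (isRoot lab) Vs) ℕ.+ length Fs         ≡⟨ roots+edges ⟩
            length Vs                                               ∎
        }
        where open ≡-Reasoning

    labelling : ∀ Fs → Fs ⊆ Es → Unique Fs → Σ (V → V) (Labelling Fs)
    labelling [] _ _ = (λ x → x) , record
      { root∈       = λ x∈ → x∈
      ; root-root   = λ _ → refl
      ; root-edge   = λ ()
      ; root-reach  = λ _ → ε
      ; roots+edges = trans (ℕP.+-identityʳ _) (length-filterᵇ-all Vs (λ _ → dec-true (_ ≟ _) refl))
      }
    labelling (e ∷ Fs) e∷Fs⊆ (e∉ ∷ !Fs) with lab , L ← labelling Fs (e∷Fs⊆ ∘ there) !Fs =
      Merge.merged L e u∈ v∈ apart , Merge.labelling L e u∈ v∈ apart
      where
      open Labelling L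
      u∈ = proj₁ (ends∈ (e∷Fs⊆ (here refl)))
      v∈ = proj₂ (ends∈ (e∷Fs⊆ (here refl)))
      apart : lab (src e) ≢ lab (tgt e)
      apart same = no-detour e∷Fs⊆ (e∉ ∷ !Fs) (root-reach u∈ ◅◅
        subst (λ r → Star (Joined Fs) r (tgt e)) (sym same) (Star.reverse joined-sym (root-reach v∈)))

    vertices≡suc-edges : ∀ {v₀} → v₀ ∈ Vs → length Vs ≡ suc (length Es)
    vertices≡suc-edges {v₀} v₀∈ with lab , L ← labelling Es (λ e∈ → e∈) !Es = begin
      length Vs                                      ≡⟨ roots+edges ⟨
      length (filterᵇ (isRoot lab) Vs) ℕ.+ length Es ≡⟨ cong (ℕ._+ length Es) one-root ⟩
      suc (length Es)                                ∎
      where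
      open ≡-Reasoning
      open Labelling L
      same-root : ∀ {a b} → Star (Joined Es) a b → lab a ≡ lab b
      same-root ε = refl
      same-root ((f , f∈ , inj₁ (refl , refl)) ◅ path) = trans (root-edge f∈) (same-root path)
      same-root ((f , f∈ , inj₂ (refl , refl)) ◅ path) = trans (sym (root-edge f∈)) (same-root path)
      one-root : length (filterᵇ (isRoot lab) Vs) ≡ 1
      one-root = trans
        (length-filterᵇ-drop {g = λ _ → false} !Vs (root∈ v₀∈) (dec-true (_ ≟ _) (root-root v₀∈)) refl only-root)
        (cong suc (length-filterᵇ-none Vs (λ _ → refl)))
        where
        only-root : ∀ {x} → x ∈ Vs → x ≢ lab v₀ → isRoot lab x ≡ false
        only-root {x} x∈ x≢r =
          dec-false (lab x ≟ x) (λ x-root → x≢r (trans (sym x-root) (same-root (connected x∈ v₀∈))))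

isOddℤ : ℤ → Bool
isOddℤ z = isOdd ∣ z ∣

isOddℤ-suc : ∀ i → isOddℤ (i + + 1) ≡ not (isOddℤ i)
isOddℤ-suc (+ n) rewrite ℕP.+-comm n 1 = refl
isOddℤ-suc -[1+ zero ]  = refl
isOddℤ-suc -[1+ suc n ] = sym (not-involutive _)

isOddℤ-pred : ∀ i → isOddℤ (i - + 1) ≡ not (isOddℤ i)
isOddℤ-pred (+ zero)  = refl
isOddℤ-pred (+ suc n) = sym (not-involutive _)
isOddℤ-pred -[1+ n ] rewrite ℕP.+-identityʳ n = refl

isOddℤ-+ : ∀ a b → isOddℤ (a + b) ≡ isOddℤ a xor isOddℤ b
isOddℤ-+ a (+ zero) = trans (cong isOddℤ (ℤP.+-identityʳ a)) (sym (xor-identityʳ _))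
isOddℤ-+ a (+ suc n) = begin
  isOddℤ (a + + suc n)         ≡⟨ cong (λ k → isOddℤ (a + k)) (ℤP.+-comm (+ 1) (+ n)) ⟩
  isOddℤ (a + (+ n + + 1))     ≡⟨ cong isOddℤ (ℤP.+-assoc a (+ n) (+ 1)) ⟨
  isOddℤ ((a + + n) + + 1)     ≡⟨ isOddℤ-suc (a + + n) ⟩
  not (isOddℤ (a + + n))       ≡⟨ cong not (isOddℤ-+ a (+ n)) ⟩
  not (isOddℤ a xor isOdd n)   ≡⟨ not-distribʳ-xor (isOddℤ a) (isOdd n) ⟩
  isOddℤ a xor not (isOdd n)   ∎
  where open ≡-Reasoning
isOddℤ-+ a -[1+ zero ] = trans (isOddℤ-pred a) (trans (sym (true-xor _)) (xor-comm true _))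
isOddℤ-+ a -[1+ suc n ] = begin
  isOddℤ (a + -[1+ suc n ])          ≡⟨ cong (λ k → isOddℤ (a + -[1+ suc k ])) (ℕP.+-identityʳ n) ⟨
  isOddℤ (a + (-[1+ n ] - + 1))      ≡⟨ cong isOddℤ (ℤP.+-assoc a -[1+ n ] -[1+ 0 ]) ⟨
  isOddℤ ((a + -[1+ n ]) - + 1)      ≡⟨ isOddℤ-pred (a + -[1+ n ]) ⟩
  not (isOddℤ (a + -[1+ n ]))        ≡⟨ cong not (isOddℤ-+ a -[1+ n ]) ⟩
  not (isOddℤ a xor isOdd (suc n))   ≡⟨ not-distribʳ-xor (isOddℤ a) (isOdd (suc n)) ⟩
  isOddℤ a xor not (isOdd (suc n))   ∎
  where open ≡-Reasoning

isOddℤ-- : ∀ a b → isOddℤ (a - b) ≡ isOddℤ a xor isOddℤ b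
isOddℤ-- a b = trans (isOddℤ-+ a (- b)) (cong (λ n → isOddℤ a xor isOdd n) (ℤP.∣-i∣≡∣i∣ b))

isOddℤ-+2 : ∀ i → isOddℤ (i + + 2) ≡ isOddℤ i
isOddℤ-+2 i = trans (isOddℤ-+ i (+ 2)) (xor-identityʳ (isOddℤ i))

isOdd≡false⇔2∣ : ∀ n → isOdd n ≡ false ⇔ 2 ℕD.∣ n
isOdd≡false⇔2∣ n = mk⇔ (to n) from
  where
  to : ∀ n → isOdd n ≡ false → 2 ℕD.∣ n
  to zero          _    = ℕD.divides 0 refl
  to (suc (suc n)) even with ℕD.divides k refl ← to n (trans (sym (not-involutive _)) even) =
    ℕD.divides (suc k) refl
  from : ∀ {n} → 2 ℕD.∣ n → isOdd n ≡ false
  from (ℕD.divides k refl) = even k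
    where
    even : ∀ k → isOdd (k * 2) ≡ false
    even zero    = refl
    even (suc k) = trans (not-involutive _) (even k)

2∣-⇒sameParity : ∀ a b → + 2 ∣ (a - b) → isOddℤ a ≡ isOddℤ b
2∣-⇒sameParity a b 2∣ =
  Equivalence.to (xor≡false⇔≡ _ _) (trans (sym (isOddℤ-- a b)) (Equivalence.from (isOdd≡false⇔2∣ _) 2∣))

sameParity⇒2∣- : ∀ a b → isOddℤ a ≡ isOddℤ b → + 2 ∣ (a - b)
sameParity⇒2∣- a b same =
  Equivalence.to (isOdd≡false⇔2∣ _) (trans (isOddℤ-- a b) (Equivalence.from (xor≡false⇔≡ _ _) same))

i≢i-1 : ∀ i → i ≢ i - + 1
i≢i-1 i i≡ = not-¬ refl (trans (cong isOddℤ i≡) (isOddℤ-pred i))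

i≢i+[1+n] : ∀ i n → i ≢ i + + suc n
i≢i+[1+n] i n i≡ with ∙-cancelˡ i (+ 0) (+ suc n) (trans (ℤP.+-identityʳ i) i≡)
... | ()

[i+1]-1≡i : ∀ i → i + + 1 - + 1 ≡ i
[i+1]-1≡i = solve-∀

[i-1]+1≡i : ∀ i → i - + 1 + + 1 ≡ i
[i-1]+1≡i = solve-∀

[i+1]+1≡i+2 : ∀ i → i + + 1 + + 1 ≡ i + + 2
[i+1]+1≡i+2 = solve-∀

[i+2]-1≡i+1 : ∀ i → i + + 2 - + 1 ≡ i + + 1
[i+2]-1≡i+1 = solve-∀

[i+2]+2≡i+4 : ∀ i → i + + 2 + + 2 ≡ i + + 4
[i+2]+2≡i+4 = solve-∀

⌊y≟b+1⌋≡⌊y-1≟b⌋ : ∀ y b → ⌊ y ℤ.≟ b + + 1 ⌋ ≡ ⌊ y - + 1 ℤ.≟ b ⌋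
⌊y≟b+1⌋≡⌊y-1≟b⌋ y b =
  ⌊⌋-cong (y ℤ.≟ b + + 1) (y - + 1 ℤ.≟ b) (λ { refl → [i+1]-1≡i b }) (λ { refl → sym ([i-1]+1≡i y) })

⌊a+1≤?x⌋≡⌊a≤?x-1⌋ : ∀ a x → ⌊ a + + 1 ℤ.≤? x ⌋ ≡ ⌊ a ℤ.≤? x - + 1 ⌋
⌊a+1≤?x⌋≡⌊a≤?x-1⌋ a x = ⌊⌋-cong (a + + 1 ℤ.≤? x) (a ℤ.≤? x - + 1)
  (λ a+1≤x → subst (ℤ._≤ x - + 1) ([i+1]-1≡i a) (ℤP.+-monoˡ-≤ (- + 1) a+1≤x))
  (λ a≤x-1 → subst (a + + 1 ℤ.≤_) ([i-1]+1≡i x) (ℤP.+-monoˡ-≤ (+ 1) a≤x-1))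

⌊a≤?x⌋-xor-⌊a+1≤?x⌋ : ∀ a x → ⌊ a ℤ.≤? x ⌋ xor ⌊ a + + 1 ℤ.≤? x ⌋ ≡ ⌊ x ℤ.≟ a ⌋
⌊a≤?x⌋-xor-⌊a+1≤?x⌋ a x with ℤP.<-cmp x a
... | tri< x<a _ _
  rewrite ⌊⌋-false (a ℤ.≤? x) (ℤP.<⇒≱ x<a)
        | ⌊⌋-false (a + + 1 ℤ.≤? x) (ℤP.<⇒≱ x<a ∘ ℤP.<⇒≤ ∘ ℤP.suc[i]≤j⇒i<j ∘ subst (ℤ._≤ x) (ℤP.+-comm a (+ 1)))
        | ⌊⌋-false (x ℤ.≟ a) (ℤP.<⇒≢ x<a) = refl
... | tri≈ _ refl _
  rewrite ⌊⌋-true (x ℤ.≤? x) ℤP.≤-refl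
        | ⌊⌋-false (x + + 1 ℤ.≤? x) (ℤP.<-irrefl refl ∘ ℤP.suc[i]≤j⇒i<j ∘ subst (ℤ._≤ x) (ℤP.+-comm x (+ 1)))
        | ⌊⌋-true (x ℤ.≟ x) refl = refl
... | tri> _ _ a<x
  rewrite ⌊⌋-true (a ℤ.≤? x) (ℤP.<⇒≤ a<x)
        | ⌊⌋-true (a + + 1 ℤ.≤? x) (subst (ℤ._≤ x) (ℤP.+-comm (+ 1) a) (ℤP.i<j⇒suc[i]≤j a<x))
        | ⌊⌋-false (x ℤ.≟ a) (ℤP.<⇒≢ a<x ∘ sym) = refl

-- The packing

_≟ᴰ_ : DecidableEquality Dir
N ≟ᴰ N = yes refl
N ≟ᴰ E = no λ ()
N ≟ᴰ S = no λ ()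
N ≟ᴰ W = no λ ()
E ≟ᴰ N = no λ ()
E ≟ᴰ E = yes refl
E ≟ᴰ S = no λ ()
E ≟ᴰ W = no λ ()
S ≟ᴰ N = no λ ()
S ≟ᴰ E = no λ ()
S ≟ᴰ S = yes refl
S ≟ᴰ W = no λ ()
W ≟ᴰ N = no λ ()
W ≟ᴰ E = no λ ()
W ≟ᴰ S = no λ ()
W ≟ᴰ W = yes refl

_≟ᴾ_ : DecidableEquality Point
_≟ᴾ_ = ×-≡-dec ℤ._≟_ ℤ._≟_

-- Spelled out, rather than derived from _≟ᴾ_, so that it computes like crossesᵇ.
_==ᴸ_ : Link → Link → Bool
((a , b) , e) ==ᴸ ((x , y) , d) = does (e ≟ᴰ d) ∧ (⌊ x ℤ.≟ a ⌋ ∧ ⌊ y ℤ.≟ b ⌋)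

==ᴸ-reflects : ∀ ℓ ℓ′ → Reflects (ℓ ≡ ℓ′) (ℓ ==ᴸ ℓ′)
==ᴸ-reflects ((a , b) , e) ((x , y) , d) with e ≟ᴰ d | x ℤ.≟ a | y ℤ.≟ b
... | yes refl | yes refl | yes refl = ofʸ refl
... | no e≢d   | _        | _        = ofⁿ (e≢d ∘ cong proj₂)
... | yes _    | no x≢a   | _        = ofⁿ (x≢a ∘ sym ∘ cong (proj₁ ∘ proj₁))
... | yes _    | yes _    | no y≢b   = ofⁿ (y≢b ∘ sym ∘ cong (proj₂ ∘ proj₁))

_≟ᴸ_ : DecidableEquality Link
ℓ ≟ᴸ ℓ′ = (ℓ ==ᴸ ℓ′) because ==ᴸ-reflects ℓ ℓ′

end₁ end₂ : Link → Point
end₁ = proj₁ ∘ endpoints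
end₂ = proj₂ ∘ endpoints

endpoints-distinct : ∀ ℓ → end₁ ℓ ≢ end₂ ℓ
endpoints-distinct ((x , y) , N) = i≢i-1 x ∘ cong proj₁
endpoints-distinct ((x , y) , E) = i≢i-1 y ∘ cong proj₂
endpoints-distinct ((x , y) , S) = i≢i-1 x ∘ sym ∘ cong proj₁
endpoints-distinct ((x , y) , W) = i≢i-1 y ∘ cong proj₂

hasEnd : Link → Point → Bool
hasEnd ℓ p = does (end₁ ℓ ≟ᴾ p) xor does (end₂ ℓ ≟ᴾ p)

hasEnd⇒HasEndpoint : ∀ ℓ {p} → hasEnd ℓ p ≡ true → HasEndpoint ℓ p
hasEnd⇒HasEndpoint ℓ {p} end with end₁ ℓ ≟ᴾ p | end₂ ℓ ≟ᴾ p
... | yes refl | _        = inj₁ refl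
... | no _     | yes refl = inj₂ refl

HasEndpoint⇒hasEnd : ∀ ℓ {p} → HasEndpoint ℓ p → hasEnd ℓ p ≡ true
HasEndpoint⇒hasEnd ℓ (inj₁ refl) = cong₂ _xor_
  (dec-true (end₁ ℓ ≟ᴾ _) refl) (dec-false (end₂ ℓ ≟ᴾ _) (endpoints-distinct ℓ ∘ sym))
HasEndpoint⇒hasEnd ℓ (inj₂ refl) = cong₂ _xor_
  (dec-false (end₁ ℓ ≟ᴾ _) (endpoints-distinct ℓ)) (dec-true (end₂ ℓ ≟ᴾ _) refl)

-- Holes of the packing sit at the points (x , y) with x - y odd; hole ℓ is the one bordered by ℓ.
hole : Link → Point
hole ((x , y) , N) = (x , y + + 1)
hole ((x , y) , E) = (x + + 1 , y)
hole ((x , y) , S) = (x , y - + 1)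
hole ((x , y) , W) = (x - + 1 , y)

hole-not-centre : ∀ ℓ → IsCentre (centre ℓ) → ¬ IsCentre (hole ℓ)
hole-not-centre ((x , y) , N) c c′ =
  not-¬ (2∣-⇒sameParity x y c) (trans (2∣-⇒sameParity x (y + + 1) c′) (isOddℤ-suc y))
hole-not-centre ((x , y) , E) c c′ =
  not-¬ (sym (2∣-⇒sameParity x y c)) (trans (sym (2∣-⇒sameParity (x + + 1) y c′)) (isOddℤ-suc x))
hole-not-centre ((x , y) , S) c c′ =
  not-¬ (2∣-⇒sameParity x y c) (trans (2∣-⇒sameParity x (y - + 1) c′) (isOddℤ-pred y))
hole-not-centre ((x , y) , W) c c′ =
  not-¬ (sym (2∣-⇒sameParity x y c)) (trans (sym (2∣-⇒sameParity (x - + 1) y c′)) (isOddℤ-pred x))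

-- The quarter of the next circle clockwise around hole ℓ; it borders the same hole.
next : Link → Link
next ((x , y) , N) = ((x - + 1 , y + + 1) , E)
next ((x , y) , E) = ((x + + 1 , y + + 1) , S)
next ((x , y) , S) = ((x + + 1 , y - + 1) , W)
next ((x , y) , W) = ((x - + 1 , y - + 1) , N)

prev : Link → Link
prev ((x , y) , N) = ((x + + 1 , y + + 1) , W)
prev ((x , y) , E) = ((x + + 1 , y - + 1) , N)
prev ((x , y) , S) = ((x - + 1 , y - + 1) , E)
prev ((x , y) , W) = ((x - + 1 , y + + 1) , S)

prev-next : ∀ ℓ → prev (next ℓ) ≡ ℓ
prev-next ((x , y) , N) = cong₂ (λ a b → ((a , b) , N)) ([i-1]+1≡i x) ([i+1]-1≡i y)
prev-next ((x , y) , E) = cong₂ (λ a b → ((a , b) , E)) ([i+1]-1≡i x) ([i+1]-1≡i y)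
prev-next ((x , y) , S) = cong₂ (λ a b → ((a , b) , S)) ([i+1]-1≡i x) ([i-1]+1≡i y)
prev-next ((x , y) , W) = cong₂ (λ a b → ((a , b) , W)) ([i-1]+1≡i x) ([i-1]+1≡i y)

next-prev : ∀ ℓ → next (prev ℓ) ≡ ℓ
next-prev ((x , y) , N) = cong₂ (λ a b → ((a , b) , N)) ([i+1]-1≡i x) ([i+1]-1≡i y)
next-prev ((x , y) , E) = cong₂ (λ a b → ((a , b) , E)) ([i+1]-1≡i x) ([i-1]+1≡i y)
next-prev ((x , y) , S) = cong₂ (λ a b → ((a , b) , S)) ([i-1]+1≡i x) ([i-1]+1≡i y)
next-prev ((x , y) , W) = cong₂ (λ a b → ((a , b) , W)) ([i-1]+1≡i x) ([i+1]-1≡i y)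

hole-next : ∀ ℓ → hole (next ℓ) ≡ hole ℓ
hole-next ((x , y) , N) = cong (_, y + + 1) ([i-1]+1≡i x)
hole-next ((x , y) , E) = cong (x + + 1 ,_) ([i+1]-1≡i y)
hole-next ((x , y) , S) = cong (_, y - + 1) ([i+1]-1≡i x)
hole-next ((x , y) , W) = cong (x - + 1 ,_) ([i-1]+1≡i y)

hole-prev : ∀ ℓ → hole (prev ℓ) ≡ hole ℓ
hole-prev ℓ = trans (sym (hole-next (prev ℓ))) (cong hole (next-prev ℓ))

record Diagonal (c c′ : Point) : Set where
  constructor flips
  field
    x-flips : isOddℤ (proj₁ c′) ≡ not (isOddℤ (proj₁ c))
    y-flips : isOddℤ (proj₂ c′) ≡ not (isOddℤ (proj₂ c))

diagonal-centre : ∀ {c c′} → Diagonal c c′ → IsCentre c → IsCentre c′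
diagonal-centre {x , y} {x′ , y′} (flips x-flips y-flips) c =
  sameParity⇒2∣- x′ y′ (trans x-flips (trans (cong not (2∣-⇒sameParity x y c)) (sym y-flips)))

diagonal-sym : ∀ {c c′} → Diagonal c c′ → Diagonal c′ c
diagonal-sym (flips x-flips y-flips) = flips (flip x-flips) (flip y-flips)
  where
  flip : ∀ {a b} → a ≡ not b → b ≡ not a
  flip refl = sym (not-involutive _)

diagonal-distinct : ∀ {c c′} → Diagonal c c′ → c ≢ c′
diagonal-distinct (flips x-flips _) refl = not-¬ refl x-flips

next-diagonal : ∀ ℓ → Diagonal (centre ℓ) (centre (next ℓ))
next-diagonal ((x , y) , N) = flips (isOddℤ-pred x) (isOddℤ-suc y)
next-diagonal ((x , y) , E) = flips (isOddℤ-suc x) (isOddℤ-suc y)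
next-diagonal ((x , y) , S) = flips (isOddℤ-suc x) (isOddℤ-pred y)
next-diagonal ((x , y) , W) = flips (isOddℤ-pred x) (isOddℤ-pred y)

-- The lower of the two circles tangent at p.
lowerCircle : Point → Point
lowerCircle (x , y) = if isOddℤ x xor isOddℤ y then (x + + 1 , y) else (x , y)

lowerCircle-same : ∀ {x y} → isOddℤ x ≡ isOddℤ y → lowerCircle (x , y) ≡ (x , y)
lowerCircle-same {x} {y} same rewrite Equivalence.from (xor≡false⇔≡ (isOddℤ x) (isOddℤ y)) same = refl

lowerCircle-diff : ∀ {x y} → isOddℤ x ≡ not (isOddℤ y) → lowerCircle (x , y) ≡ (x + + 1 , y)
lowerCircle-diff {x} {y} diff rewrite diff | xor-inverseˡ (isOddℤ y) = refl

module _ x y (c : IsCentre (x , y)) where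
  private
    x-pred-flips : isOddℤ (x - + 1) ≡ not (isOddℤ y)
    x-pred-flips = trans (isOddℤ-pred x) (cong not (2∣-⇒sameParity x y c))

  lowerCircle-NE : lowerCircle (x , y) ≡ (x , y)
  lowerCircle-NE = lowerCircle-same (2∣-⇒sameParity x y c)

  lowerCircle-NW : lowerCircle (x - + 1 , y) ≡ (x , y)
  lowerCircle-NW = trans (lowerCircle-diff x-pred-flips) (cong (_, y) ([i-1]+1≡i x))

  lowerCircle-SW : lowerCircle (x - + 1 , y - + 1) ≡ (x - + 1 , y - + 1)
  lowerCircle-SW = lowerCircle-same (trans x-pred-flips (sym (isOddℤ-pred y)))

  lowerCircle-SE : lowerCircle (x , y - + 1) ≡ (x + + 1 , y - + 1)
  lowerCircle-SE = lowerCircle-diff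
    (trans (2∣-⇒sameParity x y c) (trans (sym (not-involutive _)) (cong not (sym (isOddℤ-pred y)))))

ray-step : ∀ a x c → (c ∧ ⌊ a ℤ.≤? x ⌋) xor (c ∧ ⌊ a + + 1 ℤ.≤? x ⌋) ≡ ⌊ x ℤ.≟ a ⌋ ∧ c
ray-step a x c = begin
  (c ∧ ⌊ a ℤ.≤? x ⌋) xor (c ∧ ⌊ a + + 1 ℤ.≤? x ⌋) ≡⟨ ∧-distribˡ-xor c _ _ ⟨
  c ∧ (⌊ a ℤ.≤? x ⌋ xor ⌊ a + + 1 ℤ.≤? x ⌋)        ≡⟨ ∧-comm c _ ⟩
  (⌊ a ℤ.≤? x ⌋ xor ⌊ a + + 1 ℤ.≤? x ⌋) ∧ c        ≡⟨ cong (_∧ c) (⌊a≤?x⌋-xor-⌊a+1≤?x⌋ a x) ⟩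
  ⌊ x ℤ.≟ a ⌋ ∧ c                                  ∎
  where open ≡-Reasoning

ray-step-pred : ∀ a x c → (c ∧ ⌊ a ℤ.≤? x ⌋) xor (c ∧ ⌊ a ℤ.≤? x - + 1 ⌋) ≡ ⌊ x ℤ.≟ a ⌋ ∧ c
ray-step-pred a x c =
  trans (cong (λ t → (c ∧ ⌊ a ℤ.≤? x ⌋) xor (c ∧ t)) (sym (⌊a+1≤?x⌋≡⌊a≤?x-1⌋ a x))) (ray-step a x c)

crossesᵇ-step-east : ∀ a b ℓ →
  crossesᵇ (a , b) ℓ xor crossesᵇ (a + + 1 , b) ℓ ≡ (((a , b) , E) ==ᴸ ℓ) xor (((a + + 1 , b) , W) ==ᴸ ℓ)
crossesᵇ-step-east a b ((x , y) , N) = refl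
crossesᵇ-step-east a b ((x , y) , S) = refl
crossesᵇ-step-east a b ((x , y) , E) = trans (ray-step a x ⌊ y ℤ.≟ b ⌋) (sym (xor-identityʳ _))
crossesᵇ-step-east a b ((x , y) , W) = ray-step (a + + 1) x ⌊ y ℤ.≟ b ⌋

-- The tangency point p lies between the rays from (a , b) and from (a , b + 1).
between : Point → Point → Bool
between (a , b) p = crossesᵇ (a , b) (p , E)

crossesᵇ-step-north : ∀ a b ℓ →
  crossesᵇ (a , b) ℓ xor crossesᵇ (a , b + + 1) ℓ ≡
    ((((a , b) , N) ==ᴸ ℓ) xor (((a , b + + 1) , S) ==ᴸ ℓ)) xor
    (between (a , b) (end₁ ℓ) xor between (a , b) (end₂ ℓ))
crossesᵇ-step-north a b ((x , y) , E) rewrite ⌊y≟b+1⌋≡⌊y-1≟b⌋ y b = refl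
crossesᵇ-step-north a b ((x , y) , W) rewrite ⌊y≟b+1⌋≡⌊y-1≟b⌋ y b | ⌊a+1≤?x⌋≡⌊a≤?x-1⌋ a x = refl
crossesᵇ-step-north a b ((x , y) , N) = sym (begin
  ((⌊ x ℤ.≟ a ⌋ ∧ c) xor false) xor ((c ∧ ⌊ a ℤ.≤? x ⌋) xor (c ∧ ⌊ a ℤ.≤? x - + 1 ⌋))
    ≡⟨ cong₂ _xor_ (xor-identityʳ (⌊ x ℤ.≟ a ⌋ ∧ c)) (ray-step-pred a x c) ⟩
  (⌊ x ℤ.≟ a ⌋ ∧ c) xor (⌊ x ℤ.≟ a ⌋ ∧ c)
    ≡⟨ xor-same (⌊ x ℤ.≟ a ⌋ ∧ c) ⟩
  false ∎)
  where open ≡-Reasoning; c = ⌊ y ℤ.≟ b ⌋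
crossesᵇ-step-north a b ((x , y) , S) rewrite ⌊y≟b+1⌋≡⌊y-1≟b⌋ y b = sym (begin
  (⌊ x ℤ.≟ a ⌋ ∧ c) xor ((c ∧ ⌊ a ℤ.≤? x - + 1 ⌋) xor (c ∧ ⌊ a ℤ.≤? x ⌋))
    ≡⟨ cong ((⌊ x ℤ.≟ a ⌋ ∧ c) xor_) (trans (xor-comm (c ∧ ⌊ a ℤ.≤? x - + 1 ⌋) _) (ray-step-pred a x c)) ⟩
  (⌊ x ℤ.≟ a ⌋ ∧ c) xor (⌊ x ℤ.≟ a ⌋ ∧ c)
    ≡⟨ xor-same (⌊ x ℤ.≟ a ⌋ ∧ c) ⟩
  false ∎)
  where open ≡-Reasoning; c = ⌊ y - + 1 ℤ.≟ b ⌋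

-- The two sides of a Tangle

module Tangle (T : List Link) (tangle : IsTangle T) where
  open IsTangle tangle
  open DecMembership _≟ᴸ_ using (_∈?_)

  inside : Point → Bool
  inside p = oddCount (crossesᵇ p) T

  DiskInside⇒inside : ∀ {v} → DiskInside T v → inside v ≡ true
  DiskInside⇒inside {v} =
    trans (sym (isOdd-length-filterᵇ (crossesᵇ v) T)) ∘ Equivalence.from (isOdd⇔%2≡1 (crossings T v))

  inside⇒DiskInside : ∀ {v} → inside v ≡ true → DiskInside T v
  inside⇒DiskInside {v} =
    Equivalence.to (isOdd⇔%2≡1 (crossings T v)) ∘ trans (isOdd-length-filterᵇ (crossesᵇ v) T)

  inT : Link → Bool
  inT ℓ = does (ℓ ∈? T)

  count-inT : ∀ ℓ → oddCount (ℓ ==ᴸ_) T ≡ inT ℓ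
  count-inT ℓ = oddCount-≟ _≟ᴸ_ ℓ distinct

  inT-∈ : ∀ {ℓ} → ℓ ∈ T → inT ℓ ≡ true
  inT-∈ {ℓ} = dec-true (ℓ ∈? T)

  inT-∉ : ∀ {ℓ} → ℓ ∉ T → inT ℓ ≡ false
  inT-∉ {ℓ} = dec-false (ℓ ∈? T)

  inT⇒∈ : ∀ {ℓ} → inT ℓ ≡ true → ℓ ∈ T
  inT⇒∈ {ℓ} = does-true⇒ (ℓ ∈? T)

  off-centre : ∀ {ℓ} → ¬ IsCentre (centre ℓ) → inT ℓ ≡ false
  off-centre ¬centre = inT-∉ (¬centre ∘ centres _)

  degree-even : ∀ p → oddCount (λ ℓ → hasEnd ℓ p) T ≡ false
  degree-even p with any? (λ ℓ → hasEnd ℓ p Bool.≟ true) T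
  ... | no none = oddCount-none T (λ ℓ∈ → ¬-not (none ∘ lose ℓ∈))
  ... | yes some with ℓ , ℓ∈ , ℓ-ends ← find some with degreeTwo ℓ p ℓ∈ (hasEnd⇒HasEndpoint ℓ ℓ-ends)
  ... | ℓ′ , ℓ′∈ , ℓ′≢ℓ , p∈ℓ′ , _ , only = begin
    oddCount (λ z → hasEnd z p) T               ≡⟨ oddCount-cong T (λ z∈ → ends-at-p z∈) ⟩
    oddCount (λ z → (ℓ ==ᴸ z) xor (ℓ′ ==ᴸ z)) T  ≡⟨ oddCount-xor (ℓ ==ᴸ_) (ℓ′ ==ᴸ_) T ⟩
    oddCount (ℓ ==ᴸ_) T xor oddCount (ℓ′ ==ᴸ_) T ≡⟨ cong₂ _xor_ (count-inT ℓ) (count-inT ℓ′) ⟩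
    inT ℓ xor inT ℓ′                            ≡⟨ cong₂ _xor_ (inT-∈ ℓ∈) (inT-∈ ℓ′∈) ⟩
    false                                       ∎
    where
    open ≡-Reasoning
    ends-at-p : ∀ {z} → z ∈ T → hasEnd z p ≡ (ℓ ==ᴸ z) xor (ℓ′ ==ᴸ z)
    ends-at-p {z} z∈ with hasEnd z p in z-ends
    ... | true with only z z∈ (hasEnd⇒HasEndpoint z z-ends)
    ...   | inj₁ refl = sym (cong₂ _xor_ (dec-true (z ≟ᴸ z) refl) (dec-false (ℓ′ ≟ᴸ z) ℓ′≢ℓ))
    ...   | inj₂ refl = sym (cong₂ _xor_ (dec-false (ℓ ≟ᴸ z) (ℓ′≢ℓ ∘ sym)) (dec-true (z ≟ᴸ z) refl))
    ends-at-p {z} z∈ | false = sym (cong₂ _xor_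
      (dec-false (ℓ ≟ᴸ z) (λ { refl → not-¬ ℓ-ends z-ends }))
      (dec-false (ℓ′ ≟ᴸ z) (λ { refl → not-¬ (HasEndpoint⇒hasEnd ℓ′ p∈ℓ′) z-ends })))

  -- The boundary of the closed curve T is empty.
  endpoints-cancel : ∀ (χ : Point → Bool) → oddCount (λ ℓ → χ (end₁ ℓ) xor χ (end₂ ℓ)) T ≡ false
  endpoints-cancel χ = begin
    oddCount (λ ℓ → χ (end₁ ℓ) xor χ (end₂ ℓ)) T
      ≡⟨ oddCount-cong T (sym ∘ sum-over-ends) ⟩
    oddCount (λ ℓ → oddCount (λ p → χ p ∧ hasEnd ℓ p) ends) T
      ≡⟨ oddCount-swap (λ ℓ p → χ p ∧ hasEnd ℓ p) T ends ⟩
    oddCount (λ p → oddCount (λ ℓ → χ p ∧ hasEnd ℓ p) T) ends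
      ≡⟨ oddCount-none ends (λ {p} _ → even-at p) ⟩
    false ∎
    where
    open ≡-Reasoning
    ends : List Point
    ends = deduplicate _≟ᴾ_ (map end₁ T ++ map end₂ T)
    !ends : Unique ends
    !ends = deduplicate-! _≟ᴾ_ _
    sum-over-ends : ∀ {ℓ} → ℓ ∈ T → oddCount (λ p → χ p ∧ hasEnd ℓ p) ends ≡ χ (end₁ ℓ) xor χ (end₂ ℓ)
    sum-over-ends {ℓ} ℓ∈ = begin
      oddCount (λ p → χ p ∧ hasEnd ℓ p) ends
        ≡⟨ oddCount-cong ends (λ {p} _ → ∧-distribˡ-xor (χ p) _ _) ⟩
      oddCount (λ p → (χ p ∧ does (s ≟ᴾ p)) xor (χ p ∧ does (t ≟ᴾ p))) ends
        ≡⟨ oddCount-xor _ _ ends ⟩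
      oddCount (λ p → χ p ∧ does (s ≟ᴾ p)) ends xor oddCount (λ p → χ p ∧ does (t ≟ᴾ p)) ends
        ≡⟨ cong₂ _xor_ (oddCount-pick _≟ᴾ_ χ !ends (∈-deduplicate⁺ _≟ᴾ_ (∈-++⁺ˡ (∈-map⁺ _ ℓ∈))))
                       (oddCount-pick _≟ᴾ_ χ !ends (∈-deduplicate⁺ _≟ᴾ_ (∈-++⁺ʳ _ (∈-map⁺ _ ℓ∈)))) ⟩
      χ s xor χ t ∎
      where s = end₁ ℓ; t = end₂ ℓ
    even-at : ∀ p → oddCount (λ ℓ → χ p ∧ hasEnd ℓ p) T ≡ false
    even-at p = trans (oddCount-∧ˡ (χ p) (λ ℓ → hasEnd ℓ p) T)
                      (trans (cong (χ p ∧_) (degree-even p)) (∧-zeroʳ (χ p)))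

  inside-step-east : ∀ a b →
    inside (a , b) xor inside (a + + 1 , b) ≡ inT ((a , b) , E) xor inT ((a + + 1 , b) , W)
  inside-step-east a b = begin
    inside (a , b) xor inside (a + + 1 , b)
      ≡⟨ oddCount-xor _ _ T ⟨
    oddCount (λ ℓ → crossesᵇ (a , b) ℓ xor crossesᵇ (a + + 1 , b) ℓ) T
      ≡⟨ oddCount-cong T (λ {ℓ} _ → crossesᵇ-step-east a b ℓ) ⟩
    oddCount (λ ℓ → (((a , b) , E) ==ᴸ ℓ) xor (((a + + 1 , b) , W) ==ᴸ ℓ)) T
      ≡⟨ oddCount-xor _ _ T ⟩
    oddCount (((a , b) , E) ==ᴸ_) T xor oddCount (((a + + 1 , b) , W) ==ᴸ_) T
      ≡⟨ cong₂ _xor_ (count-inT _) (count-inT _) ⟩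
    inT ((a , b) , E) xor inT ((a + + 1 , b) , W) ∎
    where open ≡-Reasoning

  inside-step-north : ∀ a b →
    inside (a , b) xor inside (a , b + + 1) ≡ inT ((a , b) , N) xor inT ((a , b + + 1) , S)
  inside-step-north a b = begin
    inside (a , b) xor inside (a , b + + 1)
      ≡⟨ oddCount-xor _ _ T ⟨
    oddCount (λ ℓ → crossesᵇ (a , b) ℓ xor crossesᵇ (a , b + + 1) ℓ) T
      ≡⟨ oddCount-cong T (λ {ℓ} _ → crossesᵇ-step-north a b ℓ) ⟩
    oddCount (λ ℓ → ((((a , b) , N) ==ᴸ ℓ) xor (((a , b + + 1) , S) ==ᴸ ℓ)) xor
                    (between (a , b) (end₁ ℓ) xor between (a , b) (end₂ ℓ))) T
      ≡⟨ oddCount-xor _ _ T ⟩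
    oddCount (λ ℓ → (((a , b) , N) ==ᴸ ℓ) xor (((a , b + + 1) , S) ==ᴸ ℓ)) T xor
    oddCount (λ ℓ → between (a , b) (end₁ ℓ) xor between (a , b) (end₂ ℓ)) T
      ≡⟨ cong₂ _xor_ (oddCount-xor _ _ T) (endpoints-cancel (between (a , b))) ⟩
    (oddCount (((a , b) , N) ==ᴸ_) T xor oddCount (((a , b + + 1) , S) ==ᴸ_) T) xor false
      ≡⟨ xor-identityʳ _ ⟩
    oddCount (((a , b) , N) ==ᴸ_) T xor oddCount (((a , b + + 1) , S) ==ᴸ_) T
      ≡⟨ cong₂ _xor_ (count-inT _) (count-inT _) ⟩
    inT ((a , b) , N) xor inT ((a , b + + 1) , S) ∎
    where open ≡-Reasoning

  inside-step-south : ∀ a b →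
    inside (a , b - + 1) xor inside (a , b) ≡ inT ((a , b - + 1) , N) xor inT ((a , b) , S)
  inside-step-south a b = subst step ([i-1]+1≡i b) (inside-step-north a (b - + 1))
    where
    step : ℤ → Set
    step b′ = inside (a , b - + 1) xor inside (a , b′) ≡ inT ((a , b - + 1) , N) xor inT ((a , b′) , S)

  inside-step-west : ∀ a b →
    inside (a - + 1 , b) xor inside (a , b) ≡ inT ((a - + 1 , b) , E) xor inT ((a , b) , W)
  inside-step-west a b = subst step ([i-1]+1≡i a) (inside-step-east (a - + 1) b)
    where
    step : ℤ → Set
    step a′ = inside (a - + 1 , b) xor inside (a′ , b) ≡ inT ((a - + 1 , b) , E) xor inT ((a′ , b) , W)

  inside-across : ∀ ℓ → IsCentre (centre ℓ) → inside (centre ℓ) xor inside (hole ℓ) ≡ inT ℓ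
  inside-across ℓ@((x , y) , N) c =
    trans (inside-step-north x y) (xor-falseʳ (off-centre (hole-not-centre ℓ c)))
  inside-across ℓ@((x , y) , E) c =
    trans (inside-step-east x y) (xor-falseʳ (off-centre (hole-not-centre ℓ c)))
  inside-across ℓ@((x , y) , S) c = trans (xor-comm (inside (x , y)) _)
    (trans (inside-step-south x y) (xor-falseˡ (off-centre (hole-not-centre ℓ c))))
  inside-across ℓ@((x , y) , W) c = trans (xor-comm (inside (x , y)) _)
    (trans (inside-step-west x y) (xor-falseˡ (off-centre (hole-not-centre ℓ c))))

  cusp-free : ∀ {ℓ ℓ′ p} → ℓ ∈ T → HasEndpoint ℓ p → HasEndpoint ℓ′ p → ¬ SmoothJoin ℓ ℓ′ → ℓ′ ∉ T
  cusp-free ℓ∈ p∈ℓ p∈ℓ′ cusp ℓ′∈ with degreeTwo _ _ ℓ∈ p∈ℓ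
  ... | _ , _ , _ , _ , smooth , only with only _ ℓ′∈ p∈ℓ′
  ...   | inj₁ refl = cusp (inj₁ refl)
  ...   | inj₂ refl = cusp smooth

  -- The hole of ℓ is separated from centre ℓ by ℓ ∈ T, but not from centre ℓ′,
  -- since ℓ′ would make a cusp with ℓ.
  opposite-sides : ∀ {ℓ p} ℓ′ → ℓ ∈ T → IsCentre (centre ℓ′) → HasEndpoint ℓ p → HasEndpoint ℓ′ p →
    ¬ SmoothJoin ℓ ℓ′ → hole ℓ′ ≡ hole ℓ → inside (centre ℓ) xor inside (centre ℓ′) ≡ true
  opposite-sides {ℓ} ℓ′ ℓ∈ c′ p∈ℓ p∈ℓ′ cusp same-hole = begin
    inside (centre ℓ) xor inside (centre ℓ′)
      ≡⟨ xor-cancel-common (inside (centre ℓ)) (inside (centre ℓ′)) (inside (hole ℓ)) ⟨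
    (inside (centre ℓ) xor inside (hole ℓ)) xor (inside (centre ℓ′) xor inside (hole ℓ))
      ≡⟨ cong₂ _xor_ (inside-across ℓ (centres ℓ ℓ∈)) across′ ⟩
    inT ℓ xor inT ℓ′
      ≡⟨ cong₂ _xor_ (inT-∈ ℓ∈) (inT-∉ (cusp-free ℓ∈ p∈ℓ p∈ℓ′ cusp)) ⟩
    true ∎
    where
    open ≡-Reasoning
    across′ : inside (centre ℓ′) xor inside (hole ℓ) ≡ inT ℓ′
    across′ = trans (cong (λ h → inside (centre ℓ′) xor inside h) (sym same-hole)) (inside-across ℓ′ c′)

  -- Whether c is inside, relative to which of L₁, L₂ contains c.
  sideParity : Point → Bool
  sideParity (x , y) = inside (x , y) xor isOddℤ x

  across-tangency : ∀ {ℓ p} ℓ′ → ℓ ∈ T → HasEndpoint ℓ p → HasEndpoint ℓ′ p →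
    proj₂ ℓ′ ≢ opposite (proj₂ ℓ) → hole ℓ′ ≡ hole ℓ → Diagonal (centre ℓ) (centre ℓ′) →
    sideParity (centre ℓ) ≡ sideParity (centre ℓ′)
  across-tangency {ℓ} ℓ′ ℓ∈ p∈ℓ p∈ℓ′ turns same-hole diagonal = trans
    (xor-flip (inside (centre ℓ)) (inside (centre ℓ′)) (isOddℤ (proj₁ (centre ℓ)))
      (opposite-sides ℓ′ ℓ∈ (diagonal-centre diagonal (centres ℓ ℓ∈)) p∈ℓ p∈ℓ′
        [ diagonal-distinct diagonal , turns ] same-hole))
    (cong (inside (centre ℓ′) xor_) (sym (Diagonal.x-flips diagonal)))

  -- lowerCircle p is either the circle of ℓ or the other circle tangent at p, across T from it.
  sideParity-at : ∀ {ℓ p} → ℓ ∈ T → HasEndpoint ℓ p → sideParity (centre ℓ) ≡ sideParity (lowerCircle p)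
  sideParity-at {(x , y) , N} ℓ∈ (inj₁ refl) = cong sideParity (sym (lowerCircle-NE x y (centres _ ℓ∈)))
  sideParity-at {(x , y) , E} ℓ∈ (inj₁ refl) = cong sideParity (sym (lowerCircle-NE x y (centres _ ℓ∈)))
  sideParity-at {(x , y) , N} ℓ∈ (inj₂ refl) = cong sideParity (sym (lowerCircle-NW x y (centres _ ℓ∈)))
  sideParity-at {(x , y) , W} ℓ∈ (inj₁ refl) = cong sideParity (sym (lowerCircle-NW x y (centres _ ℓ∈)))
  sideParity-at {(x , y) , E} ℓ∈ (inj₂ refl) = trans
    (across-tangency ((x + + 1 , y - + 1) , N) ℓ∈
      (inj₂ refl) (inj₂ (cong (_, y - + 1) (sym ([i+1]-1≡i x)))) (λ ())
      (cong (x + + 1 ,_) ([i-1]+1≡i y)) (flips (isOddℤ-suc x) (isOddℤ-pred y)))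
    (cong sideParity (sym (lowerCircle-SE x y (centres _ ℓ∈))))
  sideParity-at {(x , y) , S} ℓ∈ (inj₁ refl) = trans
    (across-tangency ((x - + 1 , y - + 1) , E) ℓ∈ (inj₁ refl) (inj₁ refl) (λ ())
      (cong (_, y - + 1) ([i-1]+1≡i x)) (flips (isOddℤ-pred x) (isOddℤ-pred y)))
    (cong sideParity (sym (lowerCircle-SW x y (centres _ ℓ∈))))
  sideParity-at {(x , y) , S} ℓ∈ (inj₂ refl) = trans
    (across-tangency ((x + + 1 , y - + 1) , W) ℓ∈
      (inj₂ refl) (inj₁ (cong (_, y - + 1) (sym ([i+1]-1≡i x)))) (λ ())
      (cong (_, y - + 1) ([i+1]-1≡i x)) (flips (isOddℤ-suc x) (isOddℤ-pred y)))
    (cong sideParity (sym (lowerCircle-SE x y (centres _ ℓ∈))))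
  sideParity-at {(x , y) , W} ℓ∈ (inj₂ refl) = trans
    (across-tangency ((x - + 1 , y - + 1) , N) ℓ∈ (inj₂ refl) (inj₁ refl) (λ ())
      (cong (x - + 1 ,_) ([i-1]+1≡i y)) (flips (isOddℤ-pred x) (isOddℤ-pred y)))
    (cong sideParity (sym (lowerCircle-SW x y (centres _ ℓ∈))))

  sideParity-constant : ∀ {ℓ ℓ′} → ℓ ∈ T → ℓ′ ∈ T → sideParity (centre ℓ) ≡ sideParity (centre ℓ′)
  sideParity-constant ℓ∈ ℓ′∈ = along (connected _ _ ℓ∈ ℓ′∈)
    where
    along : ∀ {ℓ ℓ′} → Star (Adjacent T) ℓ ℓ′ → sideParity (centre ℓ) ≡ sideParity (centre ℓ′)
    along ε = refl
    along ((ℓ∈ , ℓ′∈ , p , p∈ℓ , p∈ℓ′) ◅ path) =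
      trans (sideParity-at ℓ∈ p∈ℓ) (trans (sym (sideParity-at ℓ′∈ p∈ℓ′)) (along path))

  σ : Bool
  σ = sideParity (centre (proj₁ nonempty))

  onLT : Point → Bool
  onLT (x , _) = σ xor isOddℤ x

  onLT-diagonal : ∀ {c c′} → Diagonal c c′ → onLT c′ ≡ not (onLT c)
  onLT-diagonal {x , _} (flips x-flips _) =
    trans (cong (σ xor_) x-flips) (sym (not-distribʳ-xor σ (isOddℤ x)))

  inside-link : ∀ {ℓ} → ℓ ∈ T → inside (centre ℓ) ≡ onLT (centre ℓ)
  inside-link {ℓ} ℓ∈ = trans (sym (xor-cancelʳ (inside (centre ℓ)) (isOddℤ (proj₁ (centre ℓ)))))
    (cong (_xor isOddℤ (proj₁ (centre ℓ))) (sideParity-constant ℓ∈ (proj₂ nonempty)))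

  facing-inner-hole : ∀ ℓ → IsCentre (centre ℓ) → onLT (centre ℓ) ≡ true → inside (hole ℓ) ≡ true →
    ℓ ∉ T × inside (centre ℓ) ≡ true
  facing-inner-hole ℓ c on-LT hole-inside = absent , xor-true≡false (trans across (inT-∉ absent))
    where
    across : inside (centre ℓ) xor true ≡ inT ℓ
    across = trans (cong (inside (centre ℓ) xor_) (sym hole-inside)) (inside-across ℓ c)
    absent : ℓ ∉ T
    absent ℓ∈ = case false≡true of λ ()
      where
      false≡true : true xor true ≡ true
      false≡true = trans (cong (_xor true) (sym (trans (inside-link ℓ∈) on-LT))) (trans across (inT-∈ ℓ∈))

  Vertex : Point → Set
  Vertex v = IsCentre v × onLT v ≡ true × inside v ≡ true

  next-of-outer : ∀ {ℓ} → ℓ ∈ T → inside (centre ℓ) ≡ false → next ℓ ∉ T × Vertex (centre (next ℓ))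
  next-of-outer {ℓ} ℓ∈ outer = proj₁ facing , c′ , on-LT , proj₂ facing
    where
    hole-inside : inside (hole ℓ) ≡ true
    hole-inside =
      trans (cong (_xor inside (hole ℓ)) (sym outer)) (trans (inside-across ℓ (centres ℓ ℓ∈)) (inT-∈ ℓ∈))
    c′ : IsCentre (centre (next ℓ))
    c′ = diagonal-centre (next-diagonal ℓ) (centres ℓ ℓ∈)
    on-LT : onLT (centre (next ℓ)) ≡ true
    on-LT = trans (onLT-diagonal (next-diagonal ℓ)) (cong not (trans (sym (inside-link ℓ∈)) outer))
    facing : next ℓ ∉ T × inside (centre (next ℓ)) ≡ true
    facing = facing-inner-hole (next ℓ) c′ on-LT (trans (cong inside (hole-next ℓ)) hole-inside)

-- The dual graph

shift-irreflexive : ∀ v d → v ≢ shift v d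
shift-irreflexive (x , y) east  = i≢i+[1+n] x 1 ∘ cong proj₁
shift-irreflexive (x , y) north = i≢i+[1+n] y 1 ∘ cong proj₂

open EdgeList {Point} {Point × EDir} proj₁ (λ (v , d) → shift v d)

shift-no-parallel : ∀ {e f} → Joins f (proj₁ e) (shift (proj₁ e) (proj₂ e)) → e ≡ f
shift-no-parallel {(x , y) , east}  {_ , east}  (inj₁ (refl , _)) = refl
shift-no-parallel {(x , y) , north} {_ , north} (inj₁ (refl , _)) = refl
shift-no-parallel {(x , y) , east}  {_ , north} (inj₁ (refl , eq)) =
  ⊥-elim (i≢i+[1+n] x 1 (cong proj₁ eq))
shift-no-parallel {(x , y) , north} {_ , east}  (inj₁ (refl , eq)) =
  ⊥-elim (i≢i+[1+n] x 1 (sym (cong proj₁ eq)))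
shift-no-parallel {(x , y) , east}  {_ , east}  (inj₂ (refl , eq)) =
  ⊥-elim (i≢i+[1+n] x 3 (trans (sym (cong proj₁ eq)) ([i+2]+2≡i+4 x)))
shift-no-parallel {(x , y) , east}  {_ , north} (inj₂ (refl , eq)) =
  ⊥-elim (i≢i+[1+n] x 1 (sym (cong proj₁ eq)))
shift-no-parallel {(x , y) , north} {_ , east}  (inj₂ (refl , eq)) =
  ⊥-elim (i≢i+[1+n] y 1 (sym (cong proj₂ eq)))
shift-no-parallel {(x , y) , north} {_ , north} (inj₂ (refl , eq)) =
  ⊥-elim (i≢i+[1+n] y 3 (trans (sym (cong proj₂ eq)) ([i+2]+2≡i+4 y)))

module DualTree (T : List Link) (tangle : IsTangle T) (tree : DualIsTree T) where
  open Tangle T tangle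
  open DualIsTree tree using (hasVertex; acyclic)
  open IsTangle tangle using (centres)

  inner-link : ∃[ ℓ ] (ℓ ∈ T × inside (centre ℓ) ≡ true)
  inner-link with _ , _ , (ℓ , ℓ∈ , ℓ-inside , _) , _ ← hasVertex =
    ℓ , ℓ∈ , DiskInside⇒inside ℓ-inside

  DualVertex⇒Vertex : ∀ {v} → DualVertex T v → Vertex v
  DualVertex⇒Vertex {x , y} (c , (ℓ , ℓ∈ , ℓ-inside , 2∣) , v-inside) =
    c , on-LT , DiskInside⇒inside v-inside
    where
    on-LT : onLT (x , y) ≡ true
    on-LT = begin
      σ xor isOddℤ x                   ≡⟨ cong (σ xor_) (2∣-⇒sameParity (proj₁ (centre ℓ)) x 2∣) ⟨
      σ xor isOddℤ (proj₁ (centre ℓ))  ≡⟨ inside-link ℓ∈ ⟨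
      inside (centre ℓ)                ≡⟨ DiskInside⇒inside ℓ-inside ⟩
      true                             ∎
      where open ≡-Reasoning

  Vertex⇒DualVertex : ∀ {v} → Vertex v → DualVertex T v
  Vertex⇒DualVertex {x , y} (c , on-LT , v-inside) with ℓ , ℓ∈ , ℓ-inside ← inner-link =
    c , (ℓ , ℓ∈ , inside⇒DiskInside ℓ-inside , sameParity⇒2∣- (proj₁ (centre ℓ)) x same-lattice) ,
    inside⇒DiskInside v-inside
    where
    same-lattice : isOddℤ (proj₁ (centre ℓ)) ≡ isOddℤ x
    same-lattice = xor-injectiveʳ σ (trans (sym (inside-link ℓ∈)) (trans ℓ-inside (sym on-LT)))

  -- If the off-lattice circle w is inside, the four circles a₁ … a₄ of L_T around it
  -- form a cycle of the dual graph.
  module InnerSquare {u v} (c₁ : IsCentre (u , v)) (on-LT₁ : onLT (u , v) ≡ true)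
                     (w-inside : inside (u + + 1 , v + + 1) ≡ true) where
    w a₁ a₂ a₃ a₄ : Point
    w  = (u + + 1 , v + + 1)
    a₁ = (u , v)
    a₂ = (u + + 2 , v)
    a₃ = (u + + 2 , v + + 2)
    a₄ = (u , v + + 2)

    w-diagonal : Diagonal a₁ w
    w-diagonal = flips (isOddℤ-suc u) (isOddℤ-suc v)

    w-absent : ∀ q → (w , q) ∉ T
    w-absent q w∈ = case trans (sym w-inside) (trans (inside-link w∈) w-off) of λ ()
      where
      w-off : onLT w ≡ false
      w-off = trans (onLT-diagonal w-diagonal) (cong not on-LT₁)

    around-w : ∀ q → inside (hole (w , q)) ≡ true
    around-w q = not-injective (trans (cong (_xor inside (hole (w , q))) (sym w-inside))
      (trans (inside-across (w , q) (diagonal-centre w-diagonal c₁)) (inT-∉ (w-absent q))))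

    south-inside : inside (u + + 1 , v) ≡ true
    south-inside = subst (λ h → inside h ≡ true) (cong (u + + 1 ,_) ([i+1]-1≡i v)) (around-w S)
    east-inside : inside (u + + 2 , v + + 1) ≡ true
    east-inside = subst (λ h → inside h ≡ true) (cong (_, v + + 1) ([i+1]+1≡i+2 u)) (around-w E)
    north-inside : inside (u + + 1 , v + + 2) ≡ true
    north-inside = subst (λ h → inside h ≡ true) (cong (u + + 1 ,_) ([i+1]+1≡i+2 v)) (around-w N)
    west-inside : inside (u , v + + 1) ≡ true
    west-inside = subst (λ h → inside h ≡ true) (cong (_, v + + 1) ([i+1]-1≡i u)) (around-w W)

    parity₁ : isOddℤ u ≡ isOddℤ v
    parity₁ = 2∣-⇒sameParity u v c₁
    c₂ : IsCentre a₂
    c₂ = sameParity⇒2∣- (u + + 2) v (trans (isOddℤ-+2 u) parity₁)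
    c₃ : IsCentre a₃
    c₃ = sameParity⇒2∣- (u + + 2) (v + + 2) (trans (isOddℤ-+2 u) (trans parity₁ (sym (isOddℤ-+2 v))))
    c₄ : IsCentre a₄
    c₄ = sameParity⇒2∣- u (v + + 2) (trans parity₁ (sym (isOddℤ-+2 v)))
    on-LT₂ : onLT a₂ ≡ true
    on-LT₂ = trans (cong (σ xor_) (isOddℤ-+2 u)) on-LT₁

    corner : ∀ ℓ → IsCentre (centre ℓ) → onLT (centre ℓ) ≡ true → ∀ {h} → hole ℓ ≡ h → inside h ≡ true →
      ℓ ∉ T × inside (centre ℓ) ≡ true
    corner ℓ c on-LT hole≡ h-inside = facing-inner-hole ℓ c on-LT (trans (cong inside hole≡) h-inside)

    a₁E = corner (a₁ , E) c₁ on-LT₁ refl south-inside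
    a₂W = corner (a₂ , W) c₂ on-LT₂ (cong (_, v) ([i+2]-1≡i+1 u)) south-inside
    a₂N = corner (a₂ , N) c₂ on-LT₂ refl east-inside
    a₃S = corner (a₃ , S) c₃ on-LT₂ (cong (u + + 2 ,_) ([i+2]-1≡i+1 v)) east-inside
    a₃W = corner (a₃ , W) c₃ on-LT₂ (cong (_, v + + 2) ([i+2]-1≡i+1 u)) north-inside
    a₄E = corner (a₄ , E) c₄ on-LT₁ refl north-inside
    a₄S = corner (a₄ , S) c₄ on-LT₁ (cong (u ,_) ([i+2]-1≡i+1 v)) west-inside
    a₁N = corner (a₁ , N) c₁ on-LT₁ refl west-inside

    v₁ : DualVertex T a₁
    v₁ = Vertex⇒DualVertex (c₁ , on-LT₁ , proj₂ a₁E)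
    v₂ : DualVertex T a₂
    v₂ = Vertex⇒DualVertex (c₂ , on-LT₂ , proj₂ a₂W)
    v₃ : DualVertex T a₃
    v₃ = Vertex⇒DualVertex (c₃ , on-LT₂ , proj₂ a₃S)
    v₄ : DualVertex T a₄
    v₄ = Vertex⇒DualVertex (c₄ , on-LT₁ , proj₂ a₄E)

    cycle : Linked (DualAdj T) (a₁ ∷ a₂ ∷ a₃ ∷ a₄ ∷ a₁ ∷ [])
    cycle = (east  , inj₁ ((v₁ , v₂ , proj₁ a₁E , proj₁ a₂W) , refl))
          ∷ (north , inj₁ ((v₂ , v₃ , proj₁ a₂N , proj₁ a₃S) , refl))
          ∷ (east  , inj₂ ((v₄ , v₃ , proj₁ a₄E , proj₁ a₃W) , refl))
          ∷ (north , inj₂ ((v₁ , v₄ , proj₁ a₁N , proj₁ a₄S) , refl))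
          ∷ [-]

    distinct : Unique (a₁ ∷ a₂ ∷ a₃ ∷ a₄ ∷ [])
    distinct = (u≢u+2 ∘ cong proj₁ ∷ u≢u+2 ∘ cong proj₁ ∷ v≢v+2 ∘ cong proj₂ ∷ [])
             ∷ (v≢v+2 ∘ cong proj₂ ∷ u≢u+2 ∘ sym ∘ cong proj₁ ∷ [])
             ∷ (u≢u+2 ∘ sym ∘ cong proj₁ ∷ [])
             ∷ [] ∷ []
      where
      u≢u+2 = i≢i+[1+n] u 1
      v≢v+2 = i≢i+[1+n] v 1

  off-lattice-outside : ∀ {w} → IsCentre w → onLT w ≡ false → inside w ≡ false
  off-lattice-outside {x , y} c off-LT = subst (λ w → inside w ≡ false) (cong₂ _,_ ([i-1]+1≡i x) ([i-1]+1≡i y))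
    (¬-not λ w-inside → acyclic _ _ (s≤s (s≤s z≤n)) (Square.distinct w-inside) (Square.cycle w-inside))
    where
    diagonal : Diagonal (x , y) (x - + 1 , y - + 1)
    diagonal = flips (isOddℤ-pred x) (isOddℤ-pred y)
    c₁ : IsCentre (x - + 1 , y - + 1)
    c₁ = diagonal-centre diagonal c
    on-LT₁ : onLT (x - + 1 , y - + 1) ≡ true
    on-LT₁ = trans (onLT-diagonal diagonal) (cong not off-LT)
    module Square = InnerSquare {x - + 1} {y - + 1} c₁ on-LT₁

  vertexQuarter : Link → Link
  vertexQuarter ℓ = if inside (centre ℓ) then ℓ else next ℓ

  vertexQuarter-vertex : ∀ {ℓ} → ℓ ∈ T → Vertex (centre (vertexQuarter ℓ))
  vertexQuarter-vertex {ℓ} ℓ∈ with inside (centre ℓ) in inner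
  ... | true  = centres ℓ ℓ∈ , trans (sym (inside-link ℓ∈)) inner , inner
  ... | false = proj₂ (next-of-outer ℓ∈ inner)

  vertexQuarter-injective : ∀ {ℓ ℓ′} → ℓ ∈ T → ℓ′ ∈ T → vertexQuarter ℓ ≡ vertexQuarter ℓ′ → ℓ ≡ ℓ′
  vertexQuarter-injective {ℓ} {ℓ′} ℓ∈ ℓ′∈ same with inside (centre ℓ) in inner | inside (centre ℓ′) in inner′
  ... | true  | true  = same
  ... | false | false = trans (sym (prev-next ℓ)) (trans (cong prev same) (prev-next ℓ′))
  ... | true  | false = ⊥-elim (proj₁ (next-of-outer ℓ′∈ inner′) (subst (_∈ T) same ℓ∈))
  ... | false | true  = ⊥-elim (proj₁ (next-of-outer ℓ∈ inner) (subst (_∈ T) (sym same) ℓ′∈))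

  vertexQuarter-surjective : ∀ {v} → Vertex v → ∀ q → ∃[ ℓ ] (ℓ ∈ T × vertexQuarter ℓ ≡ (v , q))
  vertexQuarter-surjective {v} (c , on-LT , inner) q with inT (v , q) in present
  ... | true  = (v , q) , inT⇒∈ present , cong (λ b → if b then (v , q) else next (v , q)) inner
  ... | false = ℓ , ℓ∈ , trans (cong (λ b → if b then ℓ else next ℓ) outer) (next-prev (v , q))
    where
    ℓ = prev (v , q)
    hole-inside : inside (hole (v , q)) ≡ true
    hole-inside = not-injective
      (trans (cong (_xor inside (hole (v , q))) (sym inner)) (trans (inside-across (v , q) c) present))
    diagonal : Diagonal v (centre ℓ)
    diagonal = diagonal-sym (subst (Diagonal (centre ℓ) ∘ centre) (next-prev (v , q)) (next-diagonal ℓ))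
    cℓ : IsCentre (centre ℓ)
    cℓ = diagonal-centre diagonal c
    outer : inside (centre ℓ) ≡ false
    outer = off-lattice-outside cℓ (trans (onLT-diagonal diagonal) (cong not on-LT))
    ℓ∈ : ℓ ∈ T
    ℓ∈ = inT⇒∈ (trans (sym (inside-across ℓ cℓ))
      (cong₂ _xor_ outer (trans (cong inside (hole-prev (v , q))) hole-inside)))

  vertices : List Point
  vertices = deduplicate _≟ᴾ_ (map (centre ∘ vertexQuarter) T)

  !vertices : Unique vertices
  !vertices = deduplicate-! _≟ᴾ_ _

  ∈-vertices⇔ : ∀ {v} → v ∈ vertices ⇔ Vertex v
  ∈-vertices⇔ {v} = mk⇔ to from
    where
    to : v ∈ vertices → Vertex v
    to v∈ with ℓ , ℓ∈ , refl ← ∈-map⁻ (centre ∘ vertexQuarter) (∈-deduplicate⁻ _≟ᴾ_ _ v∈) =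
      vertexQuarter-vertex ℓ∈
    from : Vertex v → v ∈ vertices
    from vertex with ℓ , ℓ∈ , ℓ↦ ← vertexQuarter-surjective vertex N =
      ∈-deduplicate⁺ _≟ᴾ_ (subst (_∈ map (centre ∘ vertexQuarter) T) (cong centre ℓ↦) (∈-map⁺ _ ℓ∈))

  directions : List Dir
  directions = N ∷ E ∷ S ∷ W ∷ []

  ∈-directions : ∀ q → q ∈ directions
  ∈-directions N = here refl
  ∈-directions E = there (here refl)
  ∈-directions S = there (there (here refl))
  ∈-directions W = there (there (there (here refl)))

  !directions : Unique directions
  !directions = ((λ ()) ∷ (λ ()) ∷ (λ ()) ∷ []) ∷ ((λ ()) ∷ (λ ()) ∷ []) ∷ ((λ ()) ∷ []) ∷ [] ∷ []

  length-links : length T ≡ length vertices * 4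
  length-links = begin
    length T
      ≡⟨ length-map vertexQuarter T ⟨
    length (map vertexQuarter T)
      ≡⟨ unique∧set⇒length≡ (unique-map⁺ distinct vertexQuarter-injective)
                            (cartesianProduct⁺ !vertices !directions) (mk⇔ to from) ⟩
    length (cartesianProduct vertices directions)
      ≡⟨ length-cartesianProduct vertices directions ⟩
    length vertices * 4 ∎
    where
    open ≡-Reasoning
    open IsTangle tangle using (distinct)
    vertex : ∀ {v q} → (v , q) ∈ cartesianProduct vertices directions → Vertex v
    vertex vq∈ = Equivalence.to ∈-vertices⇔ (proj₁ (∈-cartesianProduct⁻ vertices directions vq∈))
    to : ∀ {ℓ} → ℓ ∈ map vertexQuarter T → ℓ ∈ cartesianProduct vertices directions
    to ℓ∈ with ℓ′ , ℓ′∈ , refl ← ∈-map⁻ vertexQuarter ℓ∈ =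
      ∈-cartesianProduct⁺ (Equivalence.from ∈-vertices⇔ (vertexQuarter-vertex ℓ′∈)) (∈-directions _)
    from : ∀ {ℓ} → ℓ ∈ cartesianProduct vertices directions → ℓ ∈ map vertexQuarter T
    from {v , q} ℓ∈ with ℓ′ , ℓ′∈ , ℓ′↦ ← vertexQuarter-surjective (vertex ℓ∈) q =
      subst (_∈ map vertexQuarter T) ℓ′↦ (∈-map⁺ vertexQuarter ℓ′∈)

module DualEdges (T : List Link) (tangle : IsTangle T) (tree : DualIsTree T)
  (Es : List (Point × EDir)) (!Es : Unique Es)
  (sound : ∀ e → e ∈ Es → DualEdge T e) (complete : ∀ e → DualEdge T e → e ∈ Es) where
  open DualTree T tangle tree

  joined⇒DualAdj : ∀ {a b} → Joined Es a b → DualAdj T a b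
  joined⇒DualAdj ((v , d) , e∈ , inj₁ (refl , refl)) = d , inj₁ (sound _ e∈ , refl)
  joined⇒DualAdj ((v , d) , e∈ , inj₂ (refl , refl)) = d , inj₂ (sound _ e∈ , refl)

  DualAdj⇒joined : ∀ {a b} → DualAdj T a b → Joined Es a b
  DualAdj⇒joined {a} (d , inj₁ (edge , refl)) = (a , d) , complete _ edge , inj₁ (refl , refl)
  DualAdj⇒joined {b = b} (d , inj₂ (edge , refl)) = (b , d) , complete _ edge , inj₂ (refl , refl)

  DualVertex⇒∈ : ∀ {v} → DualVertex T v → v ∈ vertices
  DualVertex⇒∈ = Equivalence.from ∈-vertices⇔ ∘ DualVertex⇒Vertex

  vertices≡suc-edges : length vertices ≡ suc (length Es)
  vertices≡suc-edges = TreeCount.vertices≡suc-edges _≟ᴾ_ vertices Es !vertices !Es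
    (λ e∈ → DualVertex⇒∈ (proj₁ (sound _ e∈)) , DualVertex⇒∈ (proj₁ (proj₂ (sound _ e∈))))
    (λ (v , d) → shift-irreflexive v d)
    shift-no-parallel
    (λ v vs 2≤ distinct cycle → DualIsTree.acyclic tree v vs 2≤ distinct (Linked.map joined⇒DualAdj cycle))
    (λ a∈ b∈ → Star.map DualAdj⇒joined (DualIsTree.connected tree _ _ (∈⇒DualVertex a∈) (∈⇒DualVertex b∈)))
    (DualVertex⇒∈ (proj₂ (DualIsTree.hasVertex tree)))
    where
    ∈⇒DualVertex : ∀ {v} → v ∈ vertices → DualVertex T v
    ∈⇒DualVertex = Vertex⇒DualVertex ∘ Equivalence.to ∈-vertices⇔

mainTheorem1 : (T : List Link) → IsTangle T → DualIsTree T →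
               (Es : List (Point × EDir)) → Unique Es →
               (∀ e → e ∈ Es → DualEdge T e) → (∀ e → DualEdge T e → e ∈ Es) →
               (m : ℕ) → length Es ≡ m → length T ≡ 4 * suc m
mainTheorem1 T tangle tree Es !Es sound complete m refl = begin
  length T             ≡⟨ length-links ⟩
  length vertices * 4  ≡⟨ cong (_* 4) vertices≡suc-edges ⟩
  suc (length Es) * 4  ≡⟨ ℕP.*-comm (suc (length Es)) 4 ⟩
  4 * suc (length Es)  ∎
  where
  open ≡-Reasoning
  open DualTree T tangle tree
  open DualEdges T tangle tree Es !Es sound complete
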